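{- Let $q>2$ be a prime power, $n\ge1$ with $\gcd(n,q)=1$, $A_n=GF(q)[x]/(x^n-1)$. Let $h_1,h_2$ be irreducible divisors of $x^n-1$ over $GF(q)$ having the same order $N$ and degree $m>1$ with $N\ne q^m-1$, and let $J_i\subseteq A_n$ be the minimal ideal with parity-check polynomial $h_i$. For nonzero $z\in J_i$ let $r(z)$ be the number of proportionality classes met by the cycle of $z$ and $d(z)$ the number of elements of the cycle in each such class. Then $r(z)$ and $d(z)$ take one and the same pair of values for all nonzero $z\in J_1\cup J_2$.
   Context: $J_i$ is the ideal generated by $(x^n-1)/h_i(x)$. The order of a polynomial $f$ with $f(0)\ne0$ is the least $e\ge1$ with $f\mid x^e-1$. For nonzero $z\in A_n$: the cycle of $z$ is $\{x^jz:j\ge0\}$ in $A_n$; the proportionality class of $z$ is $\{\alpha z:\alpha\in GF(q)^*\}$. -}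

module Defs where

open import Level using (Level; 0ℓ)
open import Data.Nat as ℕ using (ℕ; zero; suc; _≤_; _<_; _^_; _∸_)
open import Data.Nat.Primality using (Prime)
open import Data.Fin using (Fin)
open import Data.List as List using (List; []; _∷_; length; replicate; _++_; [_])
open import Data.List.Relation.Unary.All using (All)
open import Data.List.Relation.Unary.Any using (Any)
open import Data.List.Relation.Unary.AllPairs using (AllPairs)
open import Data.List.Relation.Unary.Unique.Propositional using (Unique)
open import Data.List.Membership.Propositional using (_∈_)
open import Data.Vec as Vec using (Vec; []; _∷_)
open import Data.Product using (Σ; ∃; ∃₂; _×_; _,_)
open import Data.Sum using (_⊎_)
open import Function using (_∘_; _⇔_; _↔_)
open import Relation.Binary.PropositionalEquality using (_≡_; _≢_)
open import Relation.Nullary using (¬_)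
open import Algebra.Structures using (IsCommutativeRing)

IsPrimePower : ℕ → Set
IsPrimePower q = ∃₂ λ p k → Prime p × 1 ≤ k × q ≡ p ^ k

record FiniteField (q : ℕ) : Set₁ where
  infixl 6 _+_
  infixl 7 _*_
  field
    F      : Set
    _+_    : F → F → F
    _*_    : F → F → F
    -_     : F → F
    0#     : F
    1#     : F
    isCommutativeRing : IsCommutativeRing _≡_ _+_ _*_ -_ 0# 1#
    0≢1    : 0# ≢ 1#
    inverse : ∀ a → a ≢ 0# → ∃ λ b → a * b ≡ 1#
    enumeration : F ↔ Fin q

-- Polynomials over K (coefficient lists, lowest degree first) and the
-- quotient ring A_n = K[x]/(x^n - 1) (coefficient vectors of length n).

module PolyOps {q : ℕ} (K : FiniteField q) where
  open FiniteField K public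

  Poly : Set
  Poly = List F

  coeff : Poly → ℕ → F
  coeff []      k       = 0#
  coeff (a ∷ p) zero    = a
  coeff (a ∷ p) (suc k) = coeff p k

  -- equality of polynomials (independent of trailing zeros)
  infix 4 _≈ₚ_
  _≈ₚ_ : Poly → Poly → Set
  p ≈ₚ r = ∀ k → coeff p k ≡ coeff r k

  infixl 6 _+ₚ_
  _+ₚ_ : Poly → Poly → Poly
  []      +ₚ r       = r
  (a ∷ p) +ₚ []      = a ∷ p
  (a ∷ p) +ₚ (b ∷ r) = (a + b) ∷ (p +ₚ r)

  scaleₚ : F → Poly → Poly
  scaleₚ c = List.map (c *_)

  infixl 7 _*ₚ_
  _*ₚ_ : Poly → Poly → Poly
  []      *ₚ r = []
  (a ∷ p) *ₚ r = scaleₚ a r +ₚ (0# ∷ (p *ₚ r))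

  monomial : ℕ → Poly
  monomial e = replicate e 0# ++ [ 1# ]

  xᵉ-1 : ℕ → Poly
  xᵉ-1 e = monomial e +ₚ [ - 1# ]

  infix 4 _∣ₚ_
  _∣ₚ_ : Poly → Poly → Set
  f ∣ₚ g = ∃ λ h → f *ₚ h ≈ₚ g

  Degree : Poly → ℕ → Set
  Degree p m = coeff p m ≢ 0# × (∀ k → m < k → coeff p k ≡ 0#)

  -- units of K[x] are the nonzero constants
  IsUnitₚ : Poly → Set
  IsUnitₚ p = ∃ λ c → c ≢ 0# × p ≈ₚ [ c ]

  Irreducible : Poly → Set
  Irreducible f = ¬ (f ≈ₚ []) × ¬ IsUnitₚ f
                × (∀ a b → f ≈ₚ a *ₚ b → IsUnitₚ a ⊎ IsUnitₚ b)

  Order : Poly → ℕ → Set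
  Order f N = coeff f 0 ≢ 0# × 1 ≤ N × f ∣ₚ xᵉ-1 N
            × (∀ e → 1 ≤ e → f ∣ₚ xᵉ-1 e → N ≤ e)

  A : ℕ → Set
  A n = Vec F n

  zeroA : ∀ n → A n
  zeroA n = Vec.replicate n 0#

  -- multiplication by x in A_n (cyclic shift, since x^n = 1)
  mulX : ∀ {n} → A n → A n
  mulX []       = []
  mulX (a ∷ v)  = Vec.last (a ∷ v) ∷ Vec.init (a ∷ v)

  mulXPow : ∀ {n} → ℕ → A n → A n
  mulXPow zero    z = z
  mulXPow (suc j) z = mulX (mulXPow j z)

  addAt0 : ∀ {n} → F → A n → A n
  addAt0 c []      = []
  addAt0 c (a ∷ v) = (c + a) ∷ v

  reduce : ∀ n → Poly → A n
  reduce n []      = zeroA n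
  reduce n (c ∷ p) = addAt0 c (mulX (reduce n p))

  _•_ : ∀ {n} → F → A n → A n
  α • z = Vec.map (α *_) z

  InIdeal : ∀ n → Poly → A n → Set
  InIdeal n g z = ∃ λ a → z ≡ reduce n (a *ₚ g)

  InCycle : ∀ {n} → A n → A n → Set
  InCycle z w = ∃ λ j → w ≡ mulXPow j z

  Proportional : ∀ {n} → A n → A n → Set
  Proportional w z = ∃ λ α → α ≢ 0# × w ≡ α • z

  HasCard : ∀ {n} → (A n → Set) → ℕ → Set
  HasCard P k = Σ (List _) λ l → length l ≡ k × Unique l
              × (∀ w → (w ∈ l) ⇔ P w)

  -- r(z) = r : the cycle of z meets exactly r proportionality classes
  -- (l is a system of representatives of those classes)
  NumClasses : ∀ {n} → A n → ℕ → Set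
  NumClasses z r = Σ (List _) λ l → length l ≡ r
                 × All (InCycle z) l
                 × AllPairs (λ a b → ¬ Proportional a b) l
                 × (∀ w → InCycle z w → Any (Proportional w) l)

  ClassSize : ∀ {n} → A n → ℕ → Set
  ClassSize z d = HasCard (λ w → InCycle z w × Proportional w z) d

{-# OPTIONS --safe #-}
module Submission where

-- Write a nonzero z of the minimal ideal as z = a g with h ∤ a. Then x^j z = α x^k z exactly when
-- x^j ≡ α x^k (mod h), and since x is a unit modulo h this says x^t ≡ α for t = j − k. The nonzero
-- constants are the roots of y^(q−1) − 1 = ∏_{β ≠ 0} (y − β) (Fermat), and h is prime, so x^t is
-- congruent to a nonzero constant iff N ∣ t (q − 1), i.e. iff N / gcd(N, q − 1) divides t. Hence every
-- cycle meets N / gcd(N, q − 1) classes, each containing gcd(N, q − 1) of its elements.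

open import Defs
open import Data.Nat using (ℕ; _≤_; _<_; _^_; _∸_)
open import Data.Nat.Coprimality using (Coprime)
open import Data.Product using (∃₂; _×_)
open import Data.Sum using (_⊎_)
open import Relation.Binary.PropositionalEquality using (_≢_)

open import Level using (0ℓ)
open import Algebra.Bundles using (CommutativeRing; RawRing)
open import Algebra.Morphism.Structures using (module RingMorphisms)
open import Data.Empty using (⊥-elim)
open import Data.Fin as Fin using (Fin; toℕ; fromℕ; fromℕ<; inject₁; punchIn)
open import Data.Fin.Permutation using (Permutation; permutation)
open import Data.Fin.Properties using (inj⇒≟)
open import Data.List as List using (List; []; _∷_; length; applyUpTo)
open import Data.List.Membership.Propositional using (_∈_)
open import Data.List.Membership.Propositional.Properties using (∈-applyUpTo⁺; ∈-applyUpTo⁻)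
open import Data.List.Relation.Unary.All as All using (All; []; _∷_)
open import Data.List.Relation.Unary.AllPairs using (AllPairs; []; _∷_)
open import Data.List.Relation.Unary.Any as Any using (Any; here; there)
open import Data.Maybe using (Maybe; just; nothing)
open import Data.Nat as ℕ using (zero; suc; z≤n; s≤s; NonZero)
open import Data.Nat.Coprimality using (coprime-/gcd; coprime-divisor)
open import Data.Nat.Divisibility as ℕ using (_∣_; divides; n∣m*n; >⇒∤; m%n≡0⇒n∣m; *-monoˡ-∣; *-monoʳ-∣; *-cancelʳ-∣; ∣-trans)
open import Data.Nat.DivMod using (_/_; _%_; m≡m%n+[m/n]*n; m%n<n; m/n*n≡m)
open import Data.Nat.GCD using (gcd; gcd[m,n]∣m; gcd[m,n]∣n; gcd[m,n]≢0; m/gcd[m,n]≢0)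
open import Data.Product using (∃; _,_; proj₁; proj₂)
open import Data.Sum as Sum using (inj₁; inj₂; [_,_]; [_,_]′)
open import Data.Vec as Vec using (Vec; []; _∷_; lookup; _∷ʳ_)
open import Function using (Inverse; _⇔_; mk⇔; Equivalence; _∘_; id)
open import Function.Properties.Inverse using (↔⇒↣)
open import Relation.Binary.Bundles using (Setoid)
open import Relation.Binary.Definitions using (DecidableEquality)
open import Relation.Binary.PropositionalEquality as ≡ using (_≡_; _≗_)
open import Relation.Nullary using (¬_; Dec; yes; no)
import Algebra.Morphism.Construct.Identity as Identity
import Algebra.Properties.CommutativeMonoid.Sum as MonoidSum
import Algebra.Properties.Group as GroupProperties
import Algebra.Properties.Monoid.Mult as MonoidMult
import Algebra.Properties.Ring as RingProperties
import Algebra.Properties.Semiring.Exp as Exp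
import Algebra.Properties.Semiring.Mult as SemiringMult
import Algebra.Solver.CommutativeMonoid as MonoidSolver
import Algebra.Solver.Ring as Solver
import Algebra.Solver.Ring.AlmostCommutativeRing as ACR
import Data.Fin.Properties as Fin
import Data.List.Properties as List
import Data.List.Relation.Unary.All.Properties as All
import Data.List.Relation.Unary.AllPairs.Properties as AllPairs
import Data.List.Relation.Unary.Any.Properties as Any
import Data.List.Relation.Unary.Unique.Propositional.Properties as Unique
import Data.Nat.Properties as ℕ
import Data.Vec.Properties as Vec
import Relation.Binary.Reasoning.Setoid as SetoidReasoning

-- The ring solver needs coefficients with a (weakly) decidable equality that
-- map into the ring; a pair (a , b) of naturals stands for a − b, so that
-- additive inverses cancel in an arbitrary commutative ring.
module RingSolver (R : CommutativeRing 0ℓ 0ℓ) where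
  open CommutativeRing R
  open ≡ using (cong)
  open SetoidReasoning setoid
  open SemiringMult semiring using (×1-homo-*)
  open MonoidMult +-monoid using (×-homo-+; ×-homo-0; ×-homo-1) renaming (_×_ to _·_)
  open RingProperties ring using (-‿distribˡ-*; -‿distribʳ-*; -‿involutive; -0#≈0#; -‿+-comm)
  module M = MonoidSolver +-commutativeMonoid

  Differences : RawRing 0ℓ 0ℓ
  Differences = record
    { Carrier = ℕ × ℕ ; _≈_ = _≡_
    ; _+_ = λ { (a , b) (c , d) → a ℕ.+ c , b ℕ.+ d }
    ; _*_ = λ { (a , b) (c , d) → a ℕ.* c ℕ.+ b ℕ.* d , a ℕ.* d ℕ.+ b ℕ.* c }
    ; -_ = λ { (a , b) → b , a }
    ; 0# = 0 , 0 ; 1# = 1 , 0 }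

  ⟦_⟧ : ℕ × ℕ → Carrier
  ⟦ a , b ⟧ = a · 1# - b · 1#

  -‿cong₂ : ∀ {a b c d} → a ≈ b → c ≈ d → a - c ≈ b - d
  -‿cong₂ a≈b c≈d = +-cong a≈b (-‿cong c≈d)

  +-‿interchange : ∀ x y z w → (x + z) - (y + w) ≈ (x - y) + (z - w)
  +-‿interchange x y z w = begin
    (x + z) + - (y + w)   ≈⟨ +-congˡ (sym (-‿+-comm y w)) ⟩
    (x + z) + (- y + - w) ≈⟨ M.solve 4 (λ a b c d → (a M.⊕ b) M.⊕ (c M.⊕ d) M.⊜ (a M.⊕ c) M.⊕ (b M.⊕ d))
                                refl x z (- y) (- w) ⟩
    (x + - y) + (z + - w) ∎

  -‿*-expand : ∀ a b c d → (a - b) * (c - d) ≈ (a * c + b * d) - (a * d + b * c)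
  -‿*-expand a b c d = begin
    (a + - b) * (c + - d)                       ≈⟨ distribʳ (c + - d) a (- b) ⟩
    a * (c + - d) + - b * (c + - d)             ≈⟨ +-cong (distribˡ a c (- d)) (distribˡ (- b) c (- d)) ⟩
    (a * c + a * - d) + (- b * c + - b * - d)   ≈⟨ +-cong (+-congˡ (sym (-‿distribʳ-* a d)))
                                                          (+-cong (sym (-‿distribˡ-* b c)) -b*-d≈b*d) ⟩
    (a * c + - (a * d)) + (- (b * c) + b * d)   ≈⟨ M.solve 4 (λ p q r s → (p M.⊕ q) M.⊕ (r M.⊕ s) M.⊜ (p M.⊕ s) M.⊕ (q M.⊕ r))
                                                          refl (a * c) (- (a * d)) (- (b * c)) (b * d) ⟩
    (a * c + b * d) + (- (a * d) + - (b * c))   ≈⟨ +-congˡ (-‿+-comm (a * d) (b * c)) ⟩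
    (a * c + b * d) - (a * d + b * c)           ∎
    where
    -b*-d≈b*d : - b * - d ≈ b * d
    -b*-d≈b*d = trans (sym (-‿distribˡ-* b (- d)))
                      (trans (-‿cong (sym (-‿distribʳ-* b d))) (-‿involutive (b * d)))

  morphism : Differences ACR.-Raw-AlmostCommutative⟶ ACR.fromCommutativeRing R
  morphism = record
    { ⟦_⟧ = ⟦_⟧
    ; +-homo = λ { (a , b) (c , d) →
        trans (-‿cong₂ (×-homo-+ 1# a c) (×-homo-+ 1# b d)) (+-‿interchange _ _ _ _) }
    ; *-homo = λ { (a , b) (c , d) →
        trans (-‿cong₂ (trans (×-homo-+ 1# (a ℕ.* c) (b ℕ.* d)) (+-cong (×1-homo-* a c) (×1-homo-* b d)))
                       (trans (×-homo-+ 1# (a ℕ.* d) (b ℕ.* c)) (+-cong (×1-homo-* a d) (×1-homo-* b c))))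
              (sym (-‿*-expand _ _ _ _)) }
    ; -‿homo = λ { (a , b) →
        trans (+-congʳ (sym (-‿involutive _))) (trans (-‿+-comm _ _) (-‿cong (+-comm _ _))) }
    ; 0-homo = trans (+-cong (×-homo-0 1#) (trans (-‿cong (×-homo-0 1#)) -0#≈0#)) (+-identityʳ 0#)
    ; 1-homo = trans (+-cong (×-homo-1 1#) (trans (-‿cong (×-homo-0 1#)) -0#≈0#)) (+-identityʳ 1#)
    }

  ⟦⟧-equal? : ∀ x y → Maybe (⟦ x ⟧ ≈ ⟦ y ⟧)
  ⟦⟧-equal? (a , b) (c , d) with a ℕ.+ d ℕ.≟ c ℕ.+ b
  ... | no _ = nothing
  ... | yes a+d≡c+b = just (begin
    A - B               ≈⟨ sym (+-identityʳ _) ⟩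
    (A - B) + 0#        ≈⟨ +-congˡ (sym (-‿inverseʳ D)) ⟩
    (A - B) + (D - D)   ≈⟨ sym (+-‿interchange A B D D) ⟩
    (A + D) - (B + D)   ≈⟨ -‿cong₂ (trans (sym (×-homo-+ 1# a d))
                                          (trans (reflexive (cong (_· 1#) a+d≡c+b)) (×-homo-+ 1# c b)))
                                   (+-comm B D) ⟩
    (C + B) - (D + B)   ≈⟨ +-‿interchange C D B B ⟩
    (C - D) + (B - B)   ≈⟨ +-congˡ (-‿inverseʳ B) ⟩
    (C - D) + 0#        ≈⟨ +-identityʳ _ ⟩
    C - D               ∎)
    where A = a · 1#; B = b · 1#; C = c · 1#; D = d · 1#

  open Solver Differences (ACR.fromCommutativeRing R) morphism ⟦⟧-equal? public using (solve; _:+_; _:*_; _:-_; :-_; _:=_)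

module Field {q : ℕ} (K : FiniteField q) where
  open PolyOps K public
  open ≡ using (cong; sym; trans)

  FRing : CommutativeRing 0ℓ 0ℓ
  FRing = record { isCommutativeRing = isCommutativeRing }

  module F = CommutativeRing FRing
  module FProp = RingProperties F.ring
  module FSolver = RingSolver FRing
  module FExp = Exp F.semiring
  open FExp public using () renaming (_^_ to _^F_)

  infix 4 _≟F_
  _≟F_ : DecidableEquality F
  _≟F_ = inj⇒≟ (↔⇒↣ enumeration)

  _⁻¹⟨_⟩ : ∀ a → a ≢ 0# → F
  a ⁻¹⟨ a≢0 ⟩ = proj₁ (inverse a a≢0)

  *-inverseʳ : ∀ a (a≢0 : a ≢ 0#) → a * a ⁻¹⟨ a≢0 ⟩ ≡ 1#
  *-inverseʳ a a≢0 = proj₂ (inverse a a≢0)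

  *-inverseˡ : ∀ a (a≢0 : a ≢ 0#) → a ⁻¹⟨ a≢0 ⟩ * a ≡ 1#
  *-inverseˡ a a≢0 = trans (F.*-comm _ a) (*-inverseʳ a a≢0)

  x*y≢0 : ∀ {a b} → a ≢ 0# → b ≢ 0# → a * b ≢ 0#
  x*y≢0 {a} {b} a≢0 b≢0 ab≡0 = b≢0 (begin
    b                     ≡⟨ sym (F.*-identityˡ b) ⟩
    1# * b                ≡⟨ cong (_* b) (sym (*-inverseˡ a a≢0)) ⟩
    (a ⁻¹⟨ a≢0 ⟩ * a) * b ≡⟨ F.*-assoc _ a b ⟩
    a ⁻¹⟨ a≢0 ⟩ * (a * b) ≡⟨ cong (a ⁻¹⟨ a≢0 ⟩ *_) ab≡0 ⟩
    a ⁻¹⟨ a≢0 ⟩ * 0#      ≡⟨ F.zeroʳ _ ⟩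
    0#                    ∎)
    where open ≡.≡-Reasoning

  ⁻¹≢0 : ∀ a (a≢0 : a ≢ 0#) → a ⁻¹⟨ a≢0 ⟩ ≢ 0#
  ⁻¹≢0 a a≢0 a⁻¹≡0 = 0≢1 (trans (sym (F.zeroʳ a)) (trans (cong (a *_) (sym a⁻¹≡0)) (*-inverseʳ a a≢0)))

  x≡a*x⇒a≡1 : ∀ {a x} → x ≢ 0# → x ≡ a * x → a ≡ 1#
  x≡a*x⇒a≡1 {a} {x} x≢0 x≡ax = begin
    a                          ≡⟨ sym (F.*-identityʳ a) ⟩
    a * 1#                     ≡⟨ cong (a *_) (sym (*-inverseʳ x x≢0)) ⟩
    a * (x * x ⁻¹⟨ x≢0 ⟩)      ≡⟨ sym (F.*-assoc a x _) ⟩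
    (a * x) * x ⁻¹⟨ x≢0 ⟩      ≡⟨ cong (_* x ⁻¹⟨ x≢0 ⟩) (sym x≡ax) ⟩
    x * x ⁻¹⟨ x≢0 ⟩            ≡⟨ *-inverseʳ x x≢0 ⟩
    1#                         ∎
    where open ≡.≡-Reasoning

module PolynomialRing {q : ℕ} (K : FiniteField q) where
  open Field K public
  open ≡ using (refl; cong; cong₂; sym; trans)

  coeff-+ₚ : ∀ p r k → coeff (p +ₚ r) k ≡ coeff p k + coeff r k
  coeff-+ₚ []      r       k       = sym (F.+-identityˡ _)
  coeff-+ₚ (a ∷ p) []      zero    = sym (F.+-identityʳ _)
  coeff-+ₚ (a ∷ p) []      (suc k) = sym (F.+-identityʳ _)
  coeff-+ₚ (a ∷ p) (b ∷ r) zero    = refl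
  coeff-+ₚ (a ∷ p) (b ∷ r) (suc k) = coeff-+ₚ p r k

  coeff-scaleₚ : ∀ c r k → coeff (scaleₚ c r) k ≡ c * coeff r k
  coeff-scaleₚ c []      k       = sym (F.zeroʳ c)
  coeff-scaleₚ c (a ∷ r) zero    = refl
  coeff-scaleₚ c (a ∷ r) (suc k) = coeff-scaleₚ c r k

  -ₚ_ : Poly → Poly
  -ₚ_ = List.map -_

  coeff--ₚ : ∀ p k → coeff (-ₚ p) k ≡ - coeff p k
  coeff--ₚ []      k       = sym FProp.-0#≈0#
  coeff--ₚ (a ∷ p) zero    = refl
  coeff--ₚ (a ∷ p) (suc k) = coeff--ₚ p k

  -- _≈ₚ_ wrapped in a record, so that Agda can infer the polynomials from a proof.
  infix 4 _≋_
  record _≋_ (p r : Poly) : Set where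
    constructor mk
    field coeff-≡ : p ≈ₚ r
  open _≋_ public

  ≋-refl : ∀ {p} → p ≋ p
  ≋-refl = mk λ _ → refl

  ≋-sym : ∀ {p r} → p ≋ r → r ≋ p
  ≋-sym (mk e) = mk λ k → sym (e k)

  ≋-trans : ∀ {p r t} → p ≋ r → r ≋ t → p ≋ t
  ≋-trans (mk e) (mk f) = mk λ k → trans (e k) (f k)

  ∷-cong : ∀ {a b p r} → a ≡ b → p ≋ r → (a ∷ p) ≋ (b ∷ r)
  ∷-cong a≡b (mk e) = mk λ { zero → a≡b ; (suc k) → e k }

  ∷-tail : ∀ {a b p r} → (a ∷ p) ≋ (b ∷ r) → p ≋ r
  ∷-tail (mk e) = mk λ k → e (suc k)

  ∷≋[]⇒≋[] : ∀ {a p} → (a ∷ p) ≋ [] → p ≋ []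
  ∷≋[]⇒≋[] (mk e) = mk λ k → e (suc k)

  0∷[]≋[] : (0# ∷ []) ≋ []
  0∷[]≋[] = mk λ { zero → refl ; (suc k) → refl }

  +ₚ-cong : ∀ {p p′ r r′} → p ≋ p′ → r ≋ r′ → (p +ₚ r) ≋ (p′ +ₚ r′)
  +ₚ-cong {p} {p′} {r} {r′} (mk e) (mk f) =
    mk λ k → trans (coeff-+ₚ p r k) (trans (cong₂ _+_ (e k) (f k)) (sym (coeff-+ₚ p′ r′ k)))

  scaleₚ-cong : ∀ c {r r′} → r ≋ r′ → scaleₚ c r ≋ scaleₚ c r′
  scaleₚ-cong c {r} {r′} (mk e) =
    mk λ k → trans (coeff-scaleₚ c r k) (trans (cong (c *_) (e k)) (sym (coeff-scaleₚ c r′ k)))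

  -ₚ-cong : ∀ {p p′} → p ≋ p′ → -ₚ p ≋ -ₚ p′
  -ₚ-cong {p} {p′} (mk e) = mk λ k → trans (coeff--ₚ p k) (trans (cong -_ (e k)) (sym (coeff--ₚ p′ k)))

  scaleₚ-zero : ∀ r → scaleₚ 0# r ≋ []
  scaleₚ-zero r = mk λ k → trans (coeff-scaleₚ 0# r k) (F.zeroˡ _)

  *ₚ-zeroˡ : ∀ {p} r → p ≋ [] → (p *ₚ r) ≋ []
  *ₚ-zeroˡ {[]}    r p≋0 = ≋-refl
  *ₚ-zeroˡ {a ∷ p} r (mk e) = mk λ k →
    trans (coeff-+ₚ (scaleₚ a r) (0# ∷ p *ₚ r) k)
          (trans (cong₂ _+_ (trans (coeff-scaleₚ a r k) (trans (cong (_* coeff r k) (e zero)) (F.zeroˡ _)))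
                            (coeff-≡ (≋-trans (∷-cong refl (*ₚ-zeroˡ {p} r (mk λ j → e (suc j)))) 0∷[]≋[]) k))
                 (F.+-identityˡ 0#))

  *ₚ-congʳ : ∀ {p p′} r → p ≋ p′ → (p *ₚ r) ≋ (p′ *ₚ r)
  *ₚ-congʳ {[]}    {[]}     r e = ≋-refl
  *ₚ-congʳ {[]}    {b ∷ p′} r e = ≋-sym (*ₚ-zeroˡ r (≋-sym e))
  *ₚ-congʳ {a ∷ p} {[]}     r e = *ₚ-zeroˡ r e
  *ₚ-congʳ {a ∷ p} {b ∷ p′} r e@(mk f) =
    +ₚ-cong (mk λ k → cong (λ c → coeff (scaleₚ c r) k) (f zero)) (∷-cong refl (*ₚ-congʳ r (∷-tail e)))

  *ₚ-congˡ : ∀ p {r r′} → r ≋ r′ → (p *ₚ r) ≋ (p *ₚ r′)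
  *ₚ-congˡ []      e = ≋-refl
  *ₚ-congˡ (a ∷ p) e = +ₚ-cong (scaleₚ-cong a e) (∷-cong refl (*ₚ-congˡ p e))

  +ₚ-assoc : ∀ p r t → ((p +ₚ r) +ₚ t) ≋ (p +ₚ (r +ₚ t))
  +ₚ-assoc p r t = mk λ k →
    trans (coeff-+ₚ (p +ₚ r) t k) (trans (cong (_+ coeff t k) (coeff-+ₚ p r k))
      (trans (F.+-assoc _ _ _) (sym (trans (coeff-+ₚ p (r +ₚ t) k) (cong (coeff p k +_) (coeff-+ₚ r t k))))))

  +ₚ-comm : ∀ p r → (p +ₚ r) ≋ (r +ₚ p)
  +ₚ-comm p r = mk λ k → trans (coeff-+ₚ p r k) (trans (F.+-comm _ _) (sym (coeff-+ₚ r p k)))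

  +ₚ-identityʳ : ∀ p → (p +ₚ []) ≋ p
  +ₚ-identityʳ p = mk λ k → trans (coeff-+ₚ p [] k) (F.+-identityʳ _)

  -ₚ-inverseˡ : ∀ p → (-ₚ p +ₚ p) ≋ []
  -ₚ-inverseˡ p = mk λ k →
    trans (coeff-+ₚ (-ₚ p) p k) (trans (cong (_+ coeff p k) (coeff--ₚ p k)) (F.-‿inverseˡ _))

  *ₚ-step : ∀ a p r k → coeff ((a ∷ p) *ₚ r) k ≡ a * coeff r k + coeff (0# ∷ p *ₚ r) k
  *ₚ-step a p r k = trans (coeff-+ₚ (scaleₚ a r) _ k) (cong (_+ coeff (0# ∷ p *ₚ r) k) (coeff-scaleₚ a r k))

  *ₚ-distribʳ : ∀ p p′ r → ((p +ₚ p′) *ₚ r) ≋ ((p *ₚ r) +ₚ (p′ *ₚ r))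
  *ₚ-distribʳ []      p′       r = ≋-refl
  *ₚ-distribʳ (a ∷ p) []       r = ≋-sym (+ₚ-identityʳ _)
  *ₚ-distribʳ (a ∷ p) (b ∷ p′) r = mk λ k →
    trans (*ₚ-step (a + b) (p +ₚ p′) r k)
      (trans (cong (_ +_) (shifted k))
        (sym (trans (coeff-+ₚ ((a ∷ p) *ₚ r) _ k)
          (trans (cong₂ _+_ (*ₚ-step a p r k) (*ₚ-step b p′ r k))
            (FSolver.solve 5 (λ a b c x y → (a :* c :+ x) :+ (b :* c :+ y) := (a :+ b) :* c :+ (x :+ y))
                             refl a b (coeff r k) (coeff (0# ∷ p *ₚ r) k) (coeff (0# ∷ p′ *ₚ r) k))))))
    where
    open FSolver using (_:+_; _:*_; _:=_)
    shifted : ∀ k → coeff (0# ∷ (p +ₚ p′) *ₚ r) k ≡ coeff (0# ∷ p *ₚ r) k + coeff (0# ∷ p′ *ₚ r) k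
    shifted zero    = sym (F.+-identityʳ 0#)
    shifted (suc k) = trans (coeff-≡ (*ₚ-distribʳ p p′ r) k) (coeff-+ₚ (p *ₚ r) _ k)

  *ₚ-distribˡ : ∀ p r r′ → (p *ₚ (r +ₚ r′)) ≋ ((p *ₚ r) +ₚ (p *ₚ r′))
  *ₚ-distribˡ []      r r′ = ≋-refl
  *ₚ-distribˡ (a ∷ p) r r′ = mk λ k →
    trans (*ₚ-step a p (r +ₚ r′) k)
      (trans (cong₂ _+_ (cong (a *_) (coeff-+ₚ r r′ k)) (shifted k))
        (sym (trans (coeff-+ₚ ((a ∷ p) *ₚ r) _ k)
          (trans (cong₂ _+_ (*ₚ-step a p r k) (*ₚ-step a p r′ k))
            (FSolver.solve 5 (λ a c d x y → (a :* c :+ x) :+ (a :* d :+ y) := a :* (c :+ d) :+ (x :+ y))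
                             refl a (coeff r k) (coeff r′ k) (coeff (0# ∷ p *ₚ r) k) (coeff (0# ∷ p *ₚ r′) k))))))
    where
    open FSolver using (_:+_; _:*_; _:=_)
    shifted : ∀ k → coeff (0# ∷ p *ₚ (r +ₚ r′)) k ≡ coeff (0# ∷ p *ₚ r) k + coeff (0# ∷ p *ₚ r′) k
    shifted zero    = sym (F.+-identityʳ 0#)
    shifted (suc k) = trans (coeff-≡ (*ₚ-distribˡ p r r′) k) (coeff-+ₚ (p *ₚ r) _ k)

  *ₚ-zeroʳ : ∀ p → (p *ₚ []) ≋ []
  *ₚ-zeroʳ []      = ≋-refl
  *ₚ-zeroʳ (a ∷ p) = ≋-trans (∷-cong refl (*ₚ-zeroʳ p)) 0∷[]≋[]

  *ₚ-constʳ : ∀ p b → (p *ₚ (b ∷ [])) ≋ scaleₚ b p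
  *ₚ-constʳ []      b = ≋-refl
  *ₚ-constʳ (a ∷ p) b = mk λ { zero → trans (F.+-identityʳ _) (F.*-comm a b) ; (suc k) → coeff-≡ (*ₚ-constʳ p b) k }

  *ₚ-shiftʳ : ∀ p r → (p *ₚ (0# ∷ r)) ≋ (0# ∷ (p *ₚ r))
  *ₚ-shiftʳ []      r = ≋-sym 0∷[]≋[]
  *ₚ-shiftʳ (a ∷ p) r = ∷-cong (trans (F.+-identityʳ _) (F.zeroʳ a)) (+ₚ-cong ≋-refl (*ₚ-shiftʳ p r))

  *ₚ-shiftˡ : ∀ p r → ((0# ∷ p) *ₚ r) ≋ (0# ∷ (p *ₚ r))
  *ₚ-shiftˡ p r = ≋-trans (+ₚ-cong (scaleₚ-zero r) ≋-refl) ≋-refl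

  ∷-split : ∀ a p → (a ∷ p) ≋ ((a ∷ []) +ₚ (0# ∷ p))
  ∷-split a p = ∷-cong (sym (F.+-identityʳ a)) ≋-refl

  *ₚ-comm : ∀ p r → (p *ₚ r) ≋ (r *ₚ p)
  *ₚ-comm []      r = ≋-sym (*ₚ-zeroʳ r)
  *ₚ-comm (a ∷ p) r = ≋-sym (≋-trans (*ₚ-congˡ r (∷-split a p)) (≋-trans (*ₚ-distribˡ r _ _)
    (+ₚ-cong (*ₚ-constʳ r a) (≋-trans (*ₚ-shiftʳ r p) (∷-cong refl (*ₚ-comm r p))))))

  scaleₚ-+ₚ : ∀ c p r → scaleₚ c (p +ₚ r) ≋ (scaleₚ c p +ₚ scaleₚ c r)
  scaleₚ-+ₚ c p r = mk λ k →
    trans (coeff-scaleₚ c (p +ₚ r) k) (trans (cong (c *_) (coeff-+ₚ p r k)) (trans (F.distribˡ c _ _)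
      (sym (trans (coeff-+ₚ (scaleₚ c p) _ k) (cong₂ _+_ (coeff-scaleₚ c p k) (coeff-scaleₚ c r k))))))

  scaleₚ-scaleₚ : ∀ a b r → scaleₚ a (scaleₚ b r) ≋ scaleₚ (a * b) r
  scaleₚ-scaleₚ a b r = mk λ k →
    trans (coeff-scaleₚ a (scaleₚ b r) k) (trans (cong (a *_) (coeff-scaleₚ b r k))
      (trans (sym (F.*-assoc a b _)) (sym (coeff-scaleₚ (a * b) r k))))

  scaleₚ-*ₚ : ∀ a r t → (scaleₚ a r *ₚ t) ≋ scaleₚ a (r *ₚ t)
  scaleₚ-*ₚ a []      t = ≋-refl
  scaleₚ-*ₚ a (b ∷ r) t = ≋-trans (+ₚ-cong (≋-sym (scaleₚ-scaleₚ a b t)) (∷-cong (sym (F.zeroʳ a)) (scaleₚ-*ₚ a r t)))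
                                  (≋-sym (scaleₚ-+ₚ a (scaleₚ b t) (0# ∷ r *ₚ t)))

  *ₚ-assoc : ∀ p r t → ((p *ₚ r) *ₚ t) ≋ (p *ₚ (r *ₚ t))
  *ₚ-assoc []      r t = ≋-refl
  *ₚ-assoc (a ∷ p) r t = ≋-trans (*ₚ-distribʳ (scaleₚ a r) (0# ∷ p *ₚ r) t)
    (+ₚ-cong (scaleₚ-*ₚ a r t) (≋-trans (*ₚ-shiftˡ (p *ₚ r) t) (∷-cong refl (*ₚ-assoc p r t))))

  *ₚ-identityˡ : ∀ p → ((1# ∷ []) *ₚ p) ≋ p
  *ₚ-identityˡ p = mk λ k →
    trans (*ₚ-step 1# [] p k) (trans (cong₂ _+_ (F.*-identityˡ _) (coeff-≡ 0∷[]≋[] k)) (F.+-identityʳ _))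

  PolyRing : CommutativeRing 0ℓ 0ℓ
  PolyRing = record
    { Carrier = Poly ; _≈_ = _≋_ ; _+_ = _+ₚ_ ; _*_ = _*ₚ_ ; -_ = -ₚ_ ; 0# = [] ; 1# = 1# ∷ []
    ; isCommutativeRing = record
      { isRing = record
        { +-isAbelianGroup = record
          { isGroup = record
            { isMonoid = record
              { isSemigroup = record
                { isMagma = record { isEquivalence = record { refl = ≋-refl ; sym = ≋-sym ; trans = ≋-trans }
                                   ; ∙-cong = +ₚ-cong }
                ; assoc = +ₚ-assoc }
              ; identity = (λ _ → ≋-refl) , +ₚ-identityʳ }
            ; inverse = -ₚ-inverseˡ , (λ p → ≋-trans (+ₚ-comm p (-ₚ p)) (-ₚ-inverseˡ p))
            ; ⁻¹-cong = -ₚ-cong }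
          ; comm = +ₚ-comm }
        ; *-cong = λ {p} {p′} {r} e f → ≋-trans (*ₚ-congʳ r e) (*ₚ-congˡ p′ f)
        ; *-assoc = *ₚ-assoc
        ; *-identity = *ₚ-identityˡ , (λ p → ≋-trans (*ₚ-comm p _) (*ₚ-identityˡ p))
        ; distrib = *ₚ-distribˡ , (λ r p p′ → *ₚ-distribʳ p p′ r) }
      ; *-comm = *ₚ-comm } }

  module P = CommutativeRing PolyRing
  module PSolver = RingSolver PolyRing
  module ≋-Reasoning = SetoidReasoning P.setoid

module Divisibility {q : ℕ} (K : FiniteField q) where
  open PolynomialRing K public
  open ≡ using (refl; cong; cong₂; sym; trans)
  open P using () renaming (_-_ to _-ₚ_) public

  C : F → Poly
  C c = c ∷ []

  X : Poly
  X = 0# ∷ 1# ∷ []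

  X*ₚ : ∀ p → (X *ₚ p) ≋ (0# ∷ p)
  X*ₚ p = ≋-trans (*ₚ-shiftˡ (1# ∷ []) p) (∷-cong refl (*ₚ-identityˡ p))

  ∷≋C+X* : ∀ c p → (c ∷ p) ≋ (C c +ₚ X *ₚ p)
  ∷≋C+X* c p = ≋-trans (∷-split c p) (+ₚ-cong (≋-refl {C c}) (≋-sym (X*ₚ p)))

  scaleₚ≋C* : ∀ c p → scaleₚ c p ≋ (C c *ₚ p)
  scaleₚ≋C* c p = ≋-sym (≋-trans (+ₚ-cong (≋-refl {scaleₚ c p}) 0∷[]≋[]) (+ₚ-identityʳ _))

  C-*ₚ : ∀ a b → (C a *ₚ C b) ≋ C (a * b)
  C-*ₚ a b = ∷-cong (F.+-identityʳ _) ≋-refl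

  coeff-C* : ∀ c p k → coeff (C c *ₚ p) k ≡ c * coeff p k
  coeff-C* c p k = trans (sym (coeff-≡ (scaleₚ≋C* c p) k)) (coeff-scaleₚ c p k)

  DegreeBelow : ℕ → Poly → Set
  DegreeBelow k p = ∀ j → k ≤ j → coeff p j ≡ 0#

  DegreeBelow-resp : ∀ {k p r} → p ≋ r → DegreeBelow k p → DegreeBelow k r
  DegreeBelow-resp (mk e) p<k j k≤j = trans (sym (e j)) (p<k j k≤j)

  DegreeBelow-mono : ∀ {k k′ p} → k ≤ k′ → DegreeBelow k p → DegreeBelow k′ p
  DegreeBelow-mono k≤k′ p<k j k′≤j = p<k j (ℕ.≤-trans k≤k′ k′≤j)

  DegreeBelow-tail : ∀ {k c p} → DegreeBelow k (c ∷ p) → DegreeBelow k p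
  DegreeBelow-tail c∷p<k j k≤j = c∷p<k (suc j) (ℕ.m≤n⇒m≤1+n k≤j)

  DegreeBelow-zero : ∀ {p} → DegreeBelow 0 p → p ≋ []
  DegreeBelow-zero p<0 = mk λ j → p<0 j z≤n

  Degree⇒DegreeBelow : ∀ {d} p → Degree p d → DegreeBelow (suc d) p
  Degree⇒DegreeBelow p (_ , vanish) = vanish

  Degree<DegreeBelow : ∀ {d k} p → Degree p d → DegreeBelow k p → d < k
  Degree<DegreeBelow {d} {k} p (lead≢0 , _) p<k with d ℕ.<? k
  ... | yes d<k = d<k
  ... | no d≮k  = ⊥-elim (lead≢0 (p<k d (ℕ.≮⇒≥ d≮k)))

  ≋[]⊎Degree : ∀ p → p ≋ [] ⊎ ∃ (Degree p)
  ≋[]⊎Degree []      = inj₁ ≋-refl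
  ≋[]⊎Degree (c ∷ p) with ≋[]⊎Degree p
  ... | inj₂ (d , lead≢0 , vanish) = inj₂ (suc d , lead≢0 , λ { (suc k) (s≤s d<k) → vanish k d<k })
  ... | inj₁ p≋0 with c ≟F 0#
  ...   | yes c≡0 = inj₁ (≋-trans (∷-cong c≡0 p≋0) 0∷[]≋[])
  ...   | no c≢0  = inj₂ (0 , c≢0 , λ { (suc k) _ → coeff-≡ p≋0 k })

  Degree-scaleₚ : ∀ {c b} v → c ≢ 0# → Degree v b → Degree (scaleₚ c v) b
  Degree-scaleₚ {c} {b} v c≢0 (lead≢0 , vanish) =
      (λ e → x*y≢0 c≢0 lead≢0 (trans (sym (coeff-scaleₚ c v b)) e))
    , λ k b<k → trans (coeff-scaleₚ c v k) (trans (cong (c *_) (vanish k b<k)) (F.zeroʳ c))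

  Degree-suc : ∀ {d} p r → (∀ j → d ≤ j → coeff p (suc j) ≡ coeff r j) → Degree r d → Degree p (suc d)
  Degree-suc p r shift (lead≢0 , vanish) =
      (λ e → lead≢0 (trans (sym (shift _ ℕ.≤-refl)) e))
    , λ { (suc k) (s≤s d<k) → trans (shift k (ℕ.<⇒≤ d<k)) (vanish k d<k) }

  Degree-resp : ∀ {d p r} → p ≋ r → Degree p d → Degree r d
  Degree-resp (mk e) (lead≢0 , vanish) = (λ z → lead≢0 (trans (e _) z)) , (λ k d<k → trans (sym (e k)) (vanish k d<k))

  Degree-*ₚ : ∀ {a b} u v → Degree u a → Degree v b → Degree (u *ₚ v) (a ℕ.+ b)
  Degree-*ₚ [] v (lead≢0 , _) _ = ⊥-elim (lead≢0 refl)
  Degree-*ₚ {zero} (c ∷ u) v (c≢0 , vanish) deg-v =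
    Degree-resp (≋-sym (≋-trans (+ₚ-cong (≋-refl {scaleₚ c v}) 0∷u*v≋[]) (+ₚ-identityʳ _))) (Degree-scaleₚ v c≢0 deg-v)
    where
    0∷u*v≋[] : (0# ∷ u *ₚ v) ≋ []
    0∷u*v≋[] = ≋-trans (∷-cong refl (*ₚ-zeroˡ {u} v (mk λ k → vanish (suc k) (s≤s z≤n)))) 0∷[]≋[]
  Degree-*ₚ {suc a} {b} (c ∷ u) v (lead≢0 , vanish) deg-v@(_ , v-vanish) =
    Degree-suc ((c ∷ u) *ₚ v) (u *ₚ v) shift (Degree-*ₚ u v (lead≢0 , λ k a<k → vanish (suc k) (s≤s a<k)) deg-v)
    where
    shift : ∀ j → a ℕ.+ b ≤ j → coeff ((c ∷ u) *ₚ v) (suc j) ≡ coeff (u *ₚ v) j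
    shift j a+b≤j = trans (*ₚ-step c u v (suc j))
      (trans (cong (_+ coeff (u *ₚ v) j)
                   (trans (cong (c *_) (v-vanish (suc j) (s≤s (ℕ.≤-trans (ℕ.m≤n+m b a) a+b≤j)))) (F.zeroʳ c)))
             (F.+-identityˡ _))

  *ₚ-DegreeBelow⇒≋[] : ∀ {k} h w → Degree h k → DegreeBelow k (h *ₚ w) → w ≋ []
  *ₚ-DegreeBelow⇒≋[] {k} h w deg-h hw<k with ≋[]⊎Degree w
  ... | inj₁ w≋0         = w≋0
  ... | inj₂ (e , deg-w) = ⊥-elim (ℕ.<⇒≱ (Degree<DegreeBelow (h *ₚ w) (Degree-*ₚ h w deg-h deg-w) hw<k) (ℕ.m≤m+n k e))

  record DivisionBy (d : Poly) (k : ℕ) (p : Poly) : Set where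
    constructor division
    field
      quotient remainder : Poly
      p≋qd+r             : p ≋ quotient *ₚ d +ₚ remainder
      remainder<k        : DegreeBelow k remainder

  divMod : ∀ {d k} → Degree d k → ∀ p → DivisionBy d k p
  divMod deg-d [] = division [] [] ≋-refl (λ _ _ → refl)
  divMod {d} {k} deg-d@(lead≢0 , d-vanish) (c ∷ p) with divMod deg-d p
  ... | division quot rem p≋ rem<k = division (X *ₚ quot +ₚ C t) (s -ₚ C t *ₚ d) c∷p≋ s-td<k
    where
    open PSolver using (solve; _:+_; _:*_; _:-_; _:=_)
    s = c ∷ rem
    t = coeff s k * (coeff d k) ⁻¹⟨ lead≢0 ⟩
    c∷p≋ : (c ∷ p) ≋ (X *ₚ quot +ₚ C t) *ₚ d +ₚ (s -ₚ C t *ₚ d)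
    c∷p≋ = begin
      c ∷ p
        ≈⟨ ∷≋C+X* c p ⟩
      C c +ₚ X *ₚ p
        ≈⟨ +ₚ-cong (≋-refl {C c}) (*ₚ-congˡ X p≋) ⟩
      C c +ₚ X *ₚ (quot *ₚ d +ₚ rem)
        ≈⟨ solve 6 (λ c x p q r t → c :+ x :* (q :* p :+ r) := (x :* q :+ t) :* p :+ ((c :+ x :* r) :- t :* p))
                 ≋-refl (C c) X d quot rem (C t) ⟩
      (X *ₚ quot +ₚ C t) *ₚ d +ₚ ((C c +ₚ X *ₚ rem) -ₚ C t *ₚ d)
        ≈⟨ +ₚ-cong (≋-refl {(X *ₚ quot +ₚ C t) *ₚ d}) (+ₚ-cong (≋-sym (∷≋C+X* c rem)) (≋-refl { -ₚ (C t *ₚ d) })) ⟩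
      (X *ₚ quot +ₚ C t) *ₚ d +ₚ (s -ₚ C t *ₚ d)
        ∎
      where open ≋-Reasoning
    coeff-s-td : ∀ j → coeff (s -ₚ C t *ₚ d) j ≡ coeff s j + - (t * coeff d j)
    coeff-s-td j = trans (coeff-+ₚ s (-ₚ (C t *ₚ d)) j)
                         (cong (coeff s j +_) (trans (coeff--ₚ (C t *ₚ d) j) (cong -_ (coeff-C* t d j))))
    s-td<k : DegreeBelow k (s -ₚ C t *ₚ d)
    s-td<k j k≤j with ℕ.m≤n⇒m<n∨m≡n k≤j
    ... | inj₂ refl = trans (coeff-s-td k) (trans (cong (λ z → coeff s k + - z) cancel-lead) (F.-‿inverseʳ _))
      where
      cancel-lead : t * coeff d k ≡ coeff s k
      cancel-lead = trans (F.*-assoc _ _ _) (trans (cong (coeff s k *_) (*-inverseˡ _ lead≢0)) (F.*-identityʳ _))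
    ... | inj₁ k<j  = trans (coeff-s-td j) (trans (cong₂ (λ a b → a + - (t * b)) (rem<k-shift j k<j) (d-vanish j k<j))
                        (trans (cong (λ z → 0# + - z) (F.zeroʳ t)) (trans (F.+-identityˡ _) FProp.-0#≈0#)))
      where
      rem<k-shift : ∀ j → k < j → coeff s j ≡ 0#
      rem<k-shift (suc j) (s≤s k≤j) = rem<k j k≤j

  *ₚ-cancelˡ : ∀ {e} g {a b} → Degree g e → (g *ₚ a) ≋ (g *ₚ b) → a ≋ b
  *ₚ-cancelˡ g {a} {b} deg-g ga≋gb = begin
    a                ≈⟨ solve 2 (λ a b → a := (a :- b) :+ b) ≋-refl a b ⟩
    (a -ₚ b) +ₚ b    ≈⟨ +ₚ-cong a-b≋0 (≋-refl {b}) ⟩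
    [] +ₚ b          ≈⟨ ≋-refl ⟩
    b                ∎
    where
    open ≋-Reasoning
    open PSolver using (solve; _:+_; _:*_; _:-_; _:=_)
    g[a-b]≋0 : g *ₚ (a -ₚ b) ≋ []
    g[a-b]≋0 = begin
      g *ₚ (a -ₚ b)          ≈⟨ solve 3 (λ g a b → g :* (a :- b) := g :* a :- g :* b) ≋-refl g a b ⟩
      g *ₚ a -ₚ g *ₚ b       ≈⟨ +ₚ-cong ga≋gb (≋-refl { -ₚ (g *ₚ b) }) ⟩
      g *ₚ b -ₚ g *ₚ b       ≈⟨ P.-‿inverseʳ (g *ₚ b) ⟩
      []                     ∎
    a-b≋0 : (a -ₚ b) ≋ []
    a-b≋0 = *ₚ-DegreeBelow⇒≋[] g (a -ₚ b) deg-g (DegreeBelow-resp (≋-sym g[a-b]≋0) (λ _ _ → refl))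

  infix 4 _∣≋_
  record _∣≋_ (f p : Poly) : Set where
    constructor divides
    field
      quotient : Poly
      f*q≋p    : f *ₚ quotient ≋ p

  ∣≋-resp : ∀ {f p p′} → p ≋ p′ → f ∣≋ p → f ∣≋ p′
  ∣≋-resp p≋p′ (divides t ft≋p) = divides t (≋-trans ft≋p p≋p′)

  ∣≋-*ʳ : ∀ {f p} s → f ∣≋ p → f ∣≋ p *ₚ s
  ∣≋-*ʳ {f} s (divides t ft≋p) = divides (t *ₚ s) (≋-trans (≋-sym (*ₚ-assoc f t s)) (*ₚ-congʳ s ft≋p))

  ∣≋-*ˡ : ∀ {f p} s → f ∣≋ p → f ∣≋ s *ₚ p
  ∣≋-*ˡ {p = p} s f∣p = ∣≋-resp (*ₚ-comm p s) (∣≋-*ʳ s f∣p)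

  ∣≋-+ₚ : ∀ {f p r} → f ∣≋ p → f ∣≋ r → f ∣≋ p +ₚ r
  ∣≋-+ₚ {f} (divides t ft≋p) (divides t′ ft′≋r) =
    divides (t +ₚ t′) (≋-trans (*ₚ-distribˡ f t t′) (+ₚ-cong ft≋p ft′≋r))

  ∣≋--ₚ : ∀ {f p} → f ∣≋ p → f ∣≋ -ₚ p
  ∣≋--ₚ {f} (divides t ft≋p) = divides (-ₚ t) (≋-trans (solve 2 (λ f t → f :* (:- t) := :- (f :* t)) ≋-refl f t) (-ₚ-cong ft≋p))
    where open PSolver using (solve; _:*_; :-_; _:=_)

  ∣≋-self : ∀ f s → f ∣≋ f *ₚ s
  ∣≋-self f s = divides s ≋-refl

  ∣≋-zero : ∀ f → f ∣≋ []
  ∣≋-zero f = divides [] (*ₚ-zeroʳ f)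

  ∣≋-remainder : ∀ {f p} t s r b → p ≋ t *ₚ s +ₚ r → f ∣≋ p *ₚ b → f ∣≋ s *ₚ b → f ∣≋ r *ₚ b
  ∣≋-remainder {p = p} t s r b p≋ts+r f∣pb f∣sb = ∣≋-resp (begin
    p *ₚ b -ₚ t *ₚ (s *ₚ b)               ≈⟨ +ₚ-cong (*ₚ-congʳ b p≋ts+r) (≋-refl { -ₚ (t *ₚ (s *ₚ b)) }) ⟩
    (t *ₚ s +ₚ r) *ₚ b -ₚ t *ₚ (s *ₚ b)   ≈⟨ solve 4 (λ t s r b → (t :* s :+ r) :* b :- t :* (s :* b) := r :* b) ≋-refl t s r b ⟩
    r *ₚ b                                ∎)
    (∣≋-+ₚ f∣pb (∣≋--ₚ (∣≋-*ˡ t f∣sb)))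
    where
    open ≋-Reasoning
    open PSolver using (solve; _:+_; _:*_; _:-_; _:=_)

  module _ {h : Poly} {m : ℕ} (deg-h : Degree h m) (irreducible : Irreducible h) where
    private
      Cancels : Poly → Set
      Cancels a = ∀ b → h ∣≋ a *ₚ b → h ∣≋ b

      unit-cancels : ∀ {a} → IsUnitₚ a → Cancels a
      unit-cancels {a} (c , c≢0 , a≈c) b h∣ab = ∣≋-resp c⁻¹ab≋b (∣≋-*ˡ (C (c ⁻¹⟨ c≢0 ⟩)) h∣ab)
        where
        open ≋-Reasoning
        c⁻¹ab≋b : C (c ⁻¹⟨ c≢0 ⟩) *ₚ (a *ₚ b) ≋ b
        c⁻¹ab≋b = begin
          C (c ⁻¹⟨ c≢0 ⟩) *ₚ (a *ₚ b)     ≈⟨ *ₚ-congˡ (C (c ⁻¹⟨ c≢0 ⟩)) (*ₚ-congʳ b (mk {a} {C c} a≈c)) ⟩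
          C (c ⁻¹⟨ c≢0 ⟩) *ₚ (C c *ₚ b)   ≈⟨ ≋-sym (*ₚ-assoc (C (c ⁻¹⟨ c≢0 ⟩)) (C c) b) ⟩
          (C (c ⁻¹⟨ c≢0 ⟩) *ₚ C c) *ₚ b   ≈⟨ *ₚ-congʳ b (≋-trans (C-*ₚ _ c) (∷-cong (*-inverseˡ c c≢0) ≋-refl)) ⟩
          (1# ∷ []) *ₚ b                  ≈⟨ *ₚ-identityˡ b ⟩
          b                               ∎

      -- Euclid's argument: divide h by a; the remainder r has smaller degree and h ∣ r b,
      -- while r ≋ 0 would make a a proper factor of h.
      euclid-step : ∀ {e} a → Degree a e → DegreeBelow m a → (∀ r → DegreeBelow e r → r ≋ [] ⊎ Cancels r) → Cancels a
      euclid-step {e} a deg-a a<m smaller b h∣ab = finish (divMod deg-a h)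
        where
        finish : DivisionBy a e h → h ∣≋ b
        finish (division t r h≋ta+r r<e) =
          [ remainder-zero , (λ cancels-r → cancels-r b (∣≋-remainder t a r b h≋ta+r (∣≋-self h b) h∣ab)) ] (smaller r r<e)
          where
          remainder-zero : r ≋ [] → h ∣≋ b
          remainder-zero r≋0 =
            [ t-unit-absurd , (λ a-unit → unit-cancels {a} a-unit b h∣ab) ] (proj₂ (proj₂ irreducible) t a (coeff-≡ h≋ta))
            where
            h≋ta : h ≋ t *ₚ a
            h≋ta = ≋-trans h≋ta+r (≋-trans (+ₚ-cong (≋-refl {t *ₚ a}) r≋0) (+ₚ-identityʳ _))
            t-unit-absurd : IsUnitₚ t → h ∣≋ b
            t-unit-absurd (c , _ , t≈c) = ⊥-elim (proj₁ deg-h (begin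
              coeff h m               ≡⟨ coeff-≡ (≋-trans h≋ta (*ₚ-congʳ a (mk {t} {C c} t≈c))) m ⟩
              coeff (C c *ₚ a) m      ≡⟨ coeff-C* c a m ⟩
              c * coeff a m           ≡⟨ cong (c *_) (a<m m ℕ.≤-refl) ⟩
              c * 0#                  ≡⟨ F.zeroʳ c ⟩
              0#                      ∎))
              where open ≡.≡-Reasoning

      descent : ∀ k a → DegreeBelow k a → DegreeBelow m a → a ≋ [] ⊎ Cancels a
      descent zero    a a<0 _   = inj₁ (DegreeBelow-zero a<0)
      descent (suc k) a a≤k a<m with ≋[]⊎Degree a
      ... | inj₁ a≋0         = inj₁ a≋0
      ... | inj₂ (e , deg-a) = inj₂ (euclid-step a deg-a a<m λ r r<e →
              descent k r (DegreeBelow-mono {p = r} e≤k r<e) (DegreeBelow-mono {p = r} (ℕ.<⇒≤ (Degree<DegreeBelow a deg-a a<m)) r<e))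
        where e≤k = ℕ.≤-pred (Degree<DegreeBelow a deg-a a≤k)

    irreducible⇒prime : ∀ a b → h ∣≋ a *ₚ b → h ∣≋ a ⊎ h ∣≋ b
    irreducible⇒prime a b h∣ab = from-division (divMod deg-h a)
      where
      from-division : DivisionBy h m a → h ∣≋ a ⊎ h ∣≋ b
      from-division (division Q a′ a≋Qh+a′ a′<m) =
        [ inj₁ ∘ h∣a , (λ cancels → inj₂ (cancels b (∣≋-remainder Q h a′ b a≋Qh+a′ h∣ab (∣≋-self h b)))) ]
          (descent m a′ a′<m a′<m)
        where
        open ≋-Reasoning
        h∣a : a′ ≋ [] → h ∣≋ a
        h∣a a′≋0 = divides Q (begin
          h *ₚ Q        ≈⟨ *ₚ-comm h Q ⟩
          Q *ₚ h        ≈⟨ ≋-sym (+ₚ-identityʳ _) ⟩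
          Q *ₚ h +ₚ []  ≈⟨ +ₚ-cong (≋-refl {Q *ₚ h}) (≋-sym a′≋0) ⟩
          Q *ₚ h +ₚ a′  ≈⟨ ≋-sym a≋Qh+a′ ⟩
          a             ∎)

  ∣C⇒≡0 : ∀ {h m c} → Degree h m → 0 < m → h ∣≋ C c → c ≡ 0#
  ∣C⇒≡0 {h} {m} {c} deg-h 0<m (divides t ht≋c) = sym (coeff-≡ (≋-trans (≋-sym ht≋0) ht≋c) 0)
    where
    t≋0 : t ≋ []
    t≋0 = *ₚ-DegreeBelow⇒≋[] h t deg-h (DegreeBelow-resp (≋-sym ht≋c)
            (DegreeBelow-mono {p = C c} 0<m λ { (suc j) _ → refl }))
    ht≋0 : h *ₚ t ≋ []
    ht≋0 = ≋-trans (*ₚ-congˡ h t≋0) (*ₚ-zeroʳ h)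

module Monomials {q : ℕ} (K : FiniteField q) where
  open Divisibility K public
  open ≡ using (refl; cong; cong₂; sym; trans)
  module PExp = Exp P.semiring
  open PExp public using () renaming (_^_ to _^ₚ_)

  1ₚ : Poly
  1ₚ = 1# ∷ []

  monomial≋X^ : ∀ e → monomial e ≋ X ^ₚ e
  monomial≋X^ zero    = ≋-refl
  monomial≋X^ (suc e) = ≋-trans (∷-cong refl (monomial≋X^ e)) (≋-sym (X*ₚ (X ^ₚ e)))

  monomial-+ : ∀ a b → monomial (a ℕ.+ b) ≋ monomial a *ₚ monomial b
  monomial-+ a b = ≋-trans (monomial≋X^ (a ℕ.+ b))
    (≋-trans (PExp.^-homo-* X a b) (P.*-cong (≋-sym (monomial≋X^ a)) (≋-sym (monomial≋X^ b))))

  monomial-* : ∀ a b → monomial (a ℕ.* b) ≋ monomial a ^ₚ b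
  monomial-* a b = ≋-trans (monomial≋X^ (a ℕ.* b))
    (≋-trans (≋-sym (PExp.^-assocʳ X a b)) (PExp.^-congˡ b (≋-sym (monomial≋X^ a))))

  monomial-cong : ∀ {a b} → a ≡ b → monomial a ≋ monomial b
  monomial-cong refl = ≋-refl

  length-monomial : ∀ k → length (monomial k) ≡ suc k
  length-monomial zero    = refl
  length-monomial (suc k) = cong suc (length-monomial k)

  C-^ₚ : ∀ c k → C c ^ₚ k ≋ C (c ^F k)
  C-^ₚ c zero    = ≋-refl
  C-^ₚ c (suc k) = ≋-trans (*ₚ-congˡ (C c) (C-^ₚ c k)) (C-*ₚ c _)

  1ₚ-^ₚ : ∀ k → 1ₚ ^ₚ k ≋ 1ₚ
  1ₚ-^ₚ zero    = ≋-refl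
  1ₚ-^ₚ (suc k) = ≋-trans (*ₚ-identityˡ _) (1ₚ-^ₚ k)

  coeff-monomial : ∀ e → coeff (monomial e) e ≡ 1#
  coeff-monomial zero    = refl
  coeff-monomial (suc e) = coeff-monomial e

  coeff-monomial-< : ∀ {j} e → j < e → coeff (monomial e) j ≡ 0#
  coeff-monomial-< {zero}  (suc e) _         = refl
  coeff-monomial-< {suc j} (suc e) (s≤s j<e) = coeff-monomial-< e j<e

  Degree-monomial : ∀ e → Degree (monomial e) e
  Degree-monomial e = (λ 1≡0 → 0≢1 (sym (trans (sym (coeff-monomial e)) 1≡0))) , vanish e
    where
    vanish : ∀ e k → e < k → coeff (monomial e) k ≡ 0#
    vanish zero    (suc k) _         = refl
    vanish (suc e) (suc k) (s≤s e<k) = vanish e k e<k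

  Degree-xᵉ-1 : ∀ n′ → Degree (xᵉ-1 (suc n′)) (suc n′)
  Degree-xᵉ-1 n′ = Degree-suc (xᵉ-1 (suc n′)) (monomial n′ +ₚ []) (λ _ _ → refl)
                              (Degree-resp (≋-sym (+ₚ-identityʳ (monomial n′))) (Degree-monomial n′))

  module Modulo (h : Poly) where
    open PSolver using (solve; _:+_; _:*_; _:-_; :-_; _:=_)

    infix 4 _≈ₕ_
    record _≈ₕ_ (u v : Poly) : Set where
      constructor mk≈ₕ
      field h∣u-v : h ∣≋ u -ₚ v

    ≈ₕ-refl : ∀ {u} → u ≈ₕ u
    ≈ₕ-refl {u} = mk≈ₕ (∣≋-resp (≋-sym (P.-‿inverseʳ u)) (∣≋-zero h))

    ≈ₕ-sym : ∀ {u v} → u ≈ₕ v → v ≈ₕ u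
    ≈ₕ-sym {u} {v} (mk≈ₕ h∣u-v) = mk≈ₕ (∣≋-resp (solve 2 (λ u v → :- (u :- v) := v :- u) ≋-refl u v) (∣≋--ₚ h∣u-v))

    ≈ₕ-trans : ∀ {u v w} → u ≈ₕ v → v ≈ₕ w → u ≈ₕ w
    ≈ₕ-trans {u} {v} {w} (mk≈ₕ h∣u-v) (mk≈ₕ h∣v-w) =
      mk≈ₕ (∣≋-resp (solve 3 (λ u v w → (u :- v) :+ (v :- w) := u :- w) ≋-refl u v w) (∣≋-+ₚ h∣u-v h∣v-w))

    ≋⇒≈ₕ : ∀ {u v} → u ≋ v → u ≈ₕ v
    ≋⇒≈ₕ {u} u≋v = mk≈ₕ (∣≋-resp (+ₚ-cong (≋-refl {u}) (-ₚ-cong u≋v)) (_≈ₕ_.h∣u-v (≈ₕ-refl {u})))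

    ≈ₕ-resp : ∀ {u u′ v v′} → u ≋ u′ → v ≋ v′ → u ≈ₕ v → u′ ≈ₕ v′
    ≈ₕ-resp u≋u′ v≋v′ u≈v = ≈ₕ-trans (≋⇒≈ₕ (≋-sym u≋u′)) (≈ₕ-trans u≈v (≋⇒≈ₕ v≋v′))

    *ₚ-≈ₕ : ∀ {u v u′ v′} → u ≈ₕ v → u′ ≈ₕ v′ → u *ₚ u′ ≈ₕ v *ₚ v′
    *ₚ-≈ₕ {u} {v} {u′} {v′} (mk≈ₕ h∣u-v) (mk≈ₕ h∣u′-v′) =
      mk≈ₕ (∣≋-resp (solve 4 (λ u v u′ v′ → u :* (u′ :- v′) :+ (u :- v) :* v′ := u :* u′ :- v :* v′) ≋-refl u v u′ v′)
                    (∣≋-+ₚ (∣≋-*ˡ u h∣u′-v′) (∣≋-*ʳ v′ h∣u-v)))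

    ^ₚ-≈ₕ : ∀ {u v} k → u ≈ₕ v → u ^ₚ k ≈ₕ v ^ₚ k
    ^ₚ-≈ₕ zero    u≈v = ≈ₕ-refl
    ^ₚ-≈ₕ (suc k) u≈v = *ₚ-≈ₕ u≈v (^ₚ-≈ₕ k u≈v)

    ≈ₕ-setoid : Setoid 0ℓ 0ℓ
    ≈ₕ-setoid = record
      { Carrier = Poly ; _≈_ = _≈ₕ_
      ; isEquivalence = record { refl = ≈ₕ-refl ; sym = ≈ₕ-sym ; trans = ≈ₕ-trans } }

    module ≈ₕ-Reasoning = SetoidReasoning ≈ₕ-setoid

    ∣ₚ⇒monomial≈ₕ1 : ∀ {e} → h ∣ₚ xᵉ-1 e → monomial e ≈ₕ 1ₚ
    ∣ₚ⇒monomial≈ₕ1 (t , ht≈) = mk≈ₕ (divides t (mk ht≈))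

    monomial≈ₕ1⇒∣ₚ : ∀ {e} → monomial e ≈ₕ 1ₚ → h ∣ₚ xᵉ-1 e
    monomial≈ₕ1⇒∣ₚ (mk≈ₕ (divides t ht≋)) = t , coeff-≡ ht≋

    module OrderFacts {N : ℕ} (order : Order h N) where
      private instance
        N≢0 : ℕ.NonZero N
        N≢0 = ℕ.>-nonZero (proj₁ (proj₂ order))

      N∣⇒monomial≈ₕ1 : ∀ {j} → N ℕ.∣ j → monomial j ≈ₕ 1ₚ
      N∣⇒monomial≈ₕ1 {j} (divides k refl) =
        ≈ₕ-resp (≋-sym (≋-trans (monomial-cong (ℕ.*-comm k N)) (monomial-* N k))) (1ₚ-^ₚ k)
                (^ₚ-≈ₕ k (∣ₚ⇒monomial≈ₕ1 (proj₁ (proj₂ (proj₂ order)))))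

      monomial[j%N]≈ₕmonomial[j] : ∀ j → monomial (j % N) ≈ₕ monomial j
      monomial[j%N]≈ₕmonomial[j] j = ≈ₕ-resp (P.*-identityʳ (monomial (j % N)))
        (≋-sym (≋-trans (monomial-cong (m≡m%n+[m/n]*n j N)) (monomial-+ (j % N) _)))
        (*ₚ-≈ₕ (≈ₕ-refl {monomial (j % N)}) (≈ₕ-sym (N∣⇒monomial≈ₕ1 (ℕ.n∣m*n (j / N)))))

      monomial≈ₕ1⇒N∣ : ∀ {j} → monomial j ≈ₕ 1ₚ → N ℕ.∣ j
      monomial≈ₕ1⇒N∣ {j} x^j≈1 with j % N ℕ.≟ 0
      ... | yes j%N≡0 = m%n≡0⇒n∣m j N j%N≡0
      ... | no j%N≢0  = ⊥-elim (ℕ.<⇒≱ (m%n<n j N)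
          (minimal (j % N) (ℕ.n≢0⇒n>0 j%N≢0) (monomial≈ₕ1⇒∣ₚ (≈ₕ-trans (monomial[j%N]≈ₕmonomial[j] j) x^j≈1))))
        where minimal = proj₂ (proj₂ (proj₂ order))

module Fermat {q′ : ℕ} (K : FiniteField (suc q′)) where
  open Field K
  open ≡ using (refl; cong; cong₂; sym; trans)
  open ≡.≡-Reasoning
  open Inverse enumeration using () renaming (to to index; from to element; strictlyInverseʳ to element-index; strictlyInverseˡ to index-element)
  module Π = MonoidSum F.*-commutativeMonoid

  product≢0 : ∀ {n} (f : Fin n → F) → (∀ i → f i ≢ 0#) → Π.sum f ≢ 0#
  product≢0 {zero}  f f≢0 = λ 1≡0 → 0≢1 (sym 1≡0)
  product≢0 {suc n} f f≢0 = x*y≢0 (f≢0 Fin.zero) (product≢0 (f ∘ Fin.suc) (f≢0 ∘ Fin.suc))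

  nonzero : F → F
  nonzero β with β ≟F 0#
  ... | yes _ = 1#
  ... | no  _ = β

  nonzero≢0 : ∀ β → nonzero β ≢ 0#
  nonzero≢0 β with β ≟F 0#
  ... | yes _  = λ 1≡0 → 0≢1 (sym 1≡0)
  ... | no β≢0 = β≢0

  scale : F → Fin (suc q′) → Fin (suc q′)
  scale a i = index (a * element i)

  scale-inverse : ∀ a b → a * b ≡ 1# → ∀ i → scale a (scale b i) ≡ i
  scale-inverse a b ab≡1 i = begin
    index (a * element (index (b * element i)))   ≡⟨ cong (λ x → index (a * x)) (element-index _) ⟩
    index (a * (b * element i))                   ≡⟨ cong index (sym (F.*-assoc a b _)) ⟩
    index ((a * b) * element i)                   ≡⟨ cong (λ x → index (x * element i)) ab≡1 ⟩
    index (1# * element i)                        ≡⟨ cong index (F.*-identityˡ _) ⟩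
    index (element i)                             ≡⟨ index-element i ⟩
    i                                             ∎

  scaling : ∀ {α} → α ≢ 0# → Permutation (suc q′) (suc q′)
  scaling {α} α≢0 = permutation (scale α) (scale (α ⁻¹⟨ α≢0 ⟩))
    (scale-inverse α _ (*-inverseʳ α α≢0)) (scale-inverse _ α (*-inverseˡ α α≢0))

  module _ {α : F} (α≢0 : α ≢ 0#) where
    factor : F → F
    factor β with β ≟F 0#
    ... | yes _ = 1#
    ... | no  _ = α

    nonzero-* : ∀ β → nonzero (α * β) ≡ factor β * nonzero β
    nonzero-* β with β ≟F 0# | α * β ≟F 0#
    ... | yes _    | yes _     = sym (F.*-identityˡ 1#)
    ... | yes β≡0  | no αβ≢0   = ⊥-elim (αβ≢0 (trans (cong (α *_) β≡0) (F.zeroʳ α)))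
    ... | no β≢0   | yes αβ≡0  = ⊥-elim (x*y≢0 α≢0 β≢0 αβ≡0)
    ... | no _     | no _      = refl

    product-factor : Π.sum (factor ∘ element) ≡ α ^F q′
    product-factor = begin
      Π.sum (factor ∘ element)                                        ≡⟨ Π.sum-remove {i = index 0#} (factor ∘ element) ⟩
      factor (element (index 0#)) * Π.sum (factor ∘ element ∘ punchIn (index 0#))
                                                                      ≡⟨ cong₂ _*_ at-zero (Π.sum-cong-≗ elsewhere) ⟩
      1# * Π.sum {q′} (λ _ → α)                                       ≡⟨ F.*-identityˡ _ ⟩
      Π.sum {q′} (λ _ → α)                                            ≡⟨ Π.sum-replicate q′ ⟩
      α ^F q′                                                         ∎
      where
      at-zero : factor (element (index 0#)) ≡ 1#
      at-zero with element (index 0#) ≟F 0#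
      ... | yes _  = refl
      ... | no e≢0 = ⊥-elim (e≢0 (element-index 0#))
      elsewhere : ∀ j → factor (element (punchIn (index 0#) j)) ≡ α
      elsewhere j with element (punchIn (index 0#) j) ≟F 0#
      ... | yes e≡0 = ⊥-elim (Fin.punchInᵢ≢i (index 0#) j (trans (sym (index-element _)) (cong index e≡0)))
      ... | no _    = refl

  -- β ↦ α β permutes the elements; comparing the products of their nonzero parts gives α^(q−1) = 1.
  fermat : ∀ α → α ≢ 0# → α ^F q′ ≡ 1#
  fermat α α≢0 = x≡a*x⇒a≡1 (product≢0 (nonzero ∘ element) (nonzero≢0 ∘ element)) (begin
    Π.sum (nonzero ∘ element)                                  ≡⟨ Π.sum-permute (nonzero ∘ element) (scaling α≢0) ⟩
    Π.sum (nonzero ∘ element ∘ scale α)                        ≡⟨ Π.sum-cong-≗ (λ i → cong nonzero (element-index (α * element i))) ⟩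
    Π.sum (λ i → nonzero (α * element i))                      ≡⟨ Π.sum-cong-≗ (nonzero-* α≢0 ∘ element) ⟩
    Π.sum (λ i → factor α≢0 (element i) * nonzero (element i)) ≡⟨ Π.∑-distrib-+ (factor α≢0 ∘ element) (nonzero ∘ element) ⟩
    Π.sum (factor α≢0 ∘ element) * Π.sum (nonzero ∘ element)   ≡⟨ cong (_* Π.sum (nonzero ∘ element)) (product-factor α≢0) ⟩
    α ^F q′ * Π.sum (nonzero ∘ element)                        ∎)

module Factorisation {q : ℕ} (K : FiniteField q) where
  open Monomials K public

  IsScalarEmbedding : (R : CommutativeRing 0ℓ 0ℓ) → (F → CommutativeRing.Carrier R) → Set
  IsScalarEmbedding R = RingMorphisms.IsRingHomomorphism F.rawRing (CommutativeRing.rawRing R)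

  C-isScalarEmbedding : IsScalarEmbedding PolyRing C
  C-isScalarEmbedding = record
    { isSemiringHomomorphism = record
      { isNearSemiringHomomorphism = record
        { +-isMonoidHomomorphism = record
          { isMagmaHomomorphism = record
            { isRelHomomorphism = record { cong = λ { ≡.refl → ≋-refl } }
            ; homo = λ _ _ → ≋-refl }
          ; ε-homo = 0∷[]≋[] }
        ; *-homo = λ a b → ≋-sym (C-*ₚ a b) }
      ; 1#-homo = ≋-refl }
    ; -‿homo = λ _ → ≋-refl }

  -- quotient and remainder of the division of c ∷ p by x − α (Horner's scheme)
  synthDiv : F → F → Poly → Poly × F
  synthDiv α c []       = [] , c
  synthDiv α c (c′ ∷ p) = let (quot , rem) = synthDiv α c′ p in rem ∷ quot , c + α * rem

  synthDiv-length : ∀ α c p → length (proj₁ (synthDiv α c p)) ≡ length p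
  synthDiv-length α c []       = ≡.refl
  synthDiv-length α c (c′ ∷ p) = ≡.cong suc (synthDiv-length α c′ p)

  -- the constant left after dividing c ∷ p by x − β for every β in the list
  cofactor : List F → F → Poly → F
  cofactor []       c p        = c
  cofactor (β ∷ rs) c []       = c
  cofactor (β ∷ rs) c (c′ ∷ p) = let (quot , rem) = synthDiv β c′ p in cofactor rs rem quot

  module Evaluation (R : CommutativeRing 0ℓ 0ℓ) {ι : F → CommutativeRing.Carrier R} (ι-hom : IsScalarEmbedding R ι) where
    open CommutativeRing R renaming (_+_ to _⊕_; _*_ to _⊗_; _-_ to _⊖_; -_ to ⊝_; 0# to 𝟘; 1# to 𝟙)
    open RingMorphisms.IsRingHomomorphism ι-hom
    open SetoidReasoning setoid
    open RingSolver R using (solve; _:+_; _:*_; _:-_; _:=_)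
    open Exp semiring using () renaming (_^_ to _^ᴿ_)

    eval : Carrier → Poly → Carrier
    eval y []      = 𝟘
    eval y (c ∷ p) = ι c ⊕ y ⊗ eval y p

    product : List Carrier → Carrier
    product = List.foldr _⊗_ 𝟙

    eval-synthDiv : ∀ y α c p → let (quot , rem) = synthDiv α c p in eval y (c ∷ p) ≈ (y ⊖ ι α) ⊗ eval y quot ⊕ ι rem
    eval-synthDiv y α c []       = begin
      ι c ⊕ y ⊗ 𝟘                  ≈⟨ +-congˡ (zeroʳ y) ⟩
      ι c ⊕ 𝟘                      ≈⟨ +-comm _ _ ⟩
      𝟘 ⊕ ι c                      ≈⟨ +-congʳ (sym (zeroʳ _)) ⟩
      (y ⊖ ι α) ⊗ 𝟘 ⊕ ι c          ∎
    eval-synthDiv y α c (c′ ∷ p) = begin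
      ι c ⊕ y ⊗ eval y (c′ ∷ p)
        ≈⟨ +-congˡ (*-congˡ (eval-synthDiv y α c′ p)) ⟩
      ι c ⊕ y ⊗ ((y ⊖ ι α) ⊗ Q ⊕ ι r)
        ≈⟨ solve 5 (λ c a r y e → c :+ y :* ((y :- a) :* e :+ r) := (y :- a) :* (r :+ y :* e) :+ (c :+ a :* r))
                 refl (ι c) (ι α) (ι r) y Q ⟩
      (y ⊖ ι α) ⊗ (ι r ⊕ y ⊗ Q) ⊕ (ι c ⊕ ι α ⊗ ι r)
        ≈⟨ +-congˡ (sym (trans (+-homo c (α * r)) (+-congˡ (*-homo α r)))) ⟩
      (y ⊖ ι α) ⊗ (ι r ⊕ y ⊗ Q) ⊕ ι (c + α * r)
        ∎
      where
      r = proj₂ (synthDiv α c′ p)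
      Q = eval y (proj₁ (synthDiv α c′ p))

    eval-+ₚ : ∀ y p r → eval y (p +ₚ r) ≈ eval y p ⊕ eval y r
    eval-+ₚ y []      r       = sym (+-identityˡ _)
    eval-+ₚ y (a ∷ p) []      = sym (+-identityʳ _)
    eval-+ₚ y (a ∷ p) (b ∷ r) = begin
      ι (a + b) ⊕ y ⊗ eval y (p +ₚ r)               ≈⟨ +-cong (+-homo a b) (*-congˡ (eval-+ₚ y p r)) ⟩
      (ι a ⊕ ι b) ⊕ y ⊗ (eval y p ⊕ eval y r)       ≈⟨ solve 5 (λ a b y e f → (a :+ b) :+ y :* (e :+ f) := (a :+ y :* e) :+ (b :+ y :* f))
                                                            refl (ι a) (ι b) y (eval y p) (eval y r) ⟩
      (ι a ⊕ y ⊗ eval y p) ⊕ (ι b ⊕ y ⊗ eval y r)   ∎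

    eval-monomial : ∀ y e → eval y (monomial e) ≈ y ^ᴿ e
    eval-monomial y zero    = trans (+-cong 1#-homo (zeroʳ y)) (+-identityʳ 𝟙)
    eval-monomial y (suc e) = trans (+-cong 0#-homo (*-congˡ (eval-monomial y e))) (+-identityˡ _)

    eval-xᵉ-1 : ∀ y e → eval y (xᵉ-1 e) ≈ y ^ᴿ e ⊖ 𝟙
    eval-xᵉ-1 y e = trans (eval-+ₚ y (monomial e) (- 1# ∷ []))
      (+-cong (eval-monomial y e) (trans (+-cong (-‿homo 1#) (zeroʳ y)) (trans (+-identityʳ _) (-‿cong 1#-homo))))

  module FEval = Evaluation FRing (Identity.isRingHomomorphism F.rawRing ≡.refl)

  module _ (β c : F) (p : Poly) where
    open ≡ using (cong; sym)
    open ≡.≡-Reasoning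
    open GroupProperties F.+-group using (x∙y⁻¹≈ε⇒x≈y)
    private
      quot = proj₁ (synthDiv β c p)
      rem  = proj₂ (synthDiv β c p)

    root⇒remainder≡0 : FEval.eval β (c ∷ p) ≡ 0# → rem ≡ 0#
    root⇒remainder≡0 β-root = begin
      rem                                    ≡⟨ sym (F.+-identityˡ rem) ⟩
      0# + rem                               ≡⟨ cong (_+ rem) (sym (F.zeroˡ (FEval.eval β quot))) ⟩
      0# * FEval.eval β quot + rem           ≡⟨ cong (λ u → u * FEval.eval β quot + rem) (sym (F.-‿inverseʳ β)) ⟩
      (β + - β) * FEval.eval β quot + rem    ≡⟨ sym (FEval.eval-synthDiv β β c p) ⟩
      FEval.eval β (c ∷ p)                   ≡⟨ β-root ⟩
      0#                                     ∎

    root⇒quotient-root : ∀ x → β ≢ x → rem ≡ 0# → FEval.eval x (c ∷ p) ≡ 0# → FEval.eval x quot ≡ 0#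
    root⇒quotient-root x β≢x rem≡0 x-root with FEval.eval x quot ≟F 0#
    ... | yes quot-root = quot-root
    ... | no ¬quot-root = ⊥-elim (x*y≢0 (λ x-β≡0 → β≢x (sym (x∙y⁻¹≈ε⇒x≈y x β x-β≡0))) ¬quot-root (begin
      (x + - β) * FEval.eval x quot          ≡⟨ sym (F.+-identityʳ _) ⟩
      (x + - β) * FEval.eval x quot + 0#     ≡⟨ cong ((x + - β) * FEval.eval x quot +_) (sym rem≡0) ⟩
      (x + - β) * FEval.eval x quot + rem    ≡⟨ sym (FEval.eval-synthDiv x β c p) ⟩
      FEval.eval x (c ∷ p)                   ≡⟨ x-root ⟩
      0#                                     ∎))

  module Factor (R : CommutativeRing 0ℓ 0ℓ) {ι : F → CommutativeRing.Carrier R} (ι-hom : IsScalarEmbedding R ι) where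
    open CommutativeRing R renaming (_+_ to _⊕_; _*_ to _⊗_; _-_ to _⊖_; -_ to ⊝_; 0# to 𝟘; 1# to 𝟙)
    open RingMorphisms.IsRingHomomorphism ι-hom
    open Evaluation R ι-hom public
    open SetoidReasoning setoid
    open RingSolver R using (solve; _:*_; _:=_)

    -- length p ≡ length rs bounds the degree of c ∷ p by the number of roots.
    factor-roots : ∀ rs c p → AllPairs _≢_ rs → All (λ β → FEval.eval β (c ∷ p) ≡ 0#) rs → length p ≡ length rs →
                   ∀ y → eval y (c ∷ p) ≈ ι (cofactor rs c p) ⊗ product (List.map (λ β → y ⊖ ι β) rs)
    factor-roots []       c []       _ _ _ y = begin
      ι c ⊕ y ⊗ 𝟘    ≈⟨ +-congˡ (zeroʳ y) ⟩
      ι c ⊕ 𝟘        ≈⟨ +-identityʳ _ ⟩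
      ι c            ≈⟨ sym (*-identityʳ _) ⟩
      ι c ⊗ 𝟙        ∎
    factor-roots (β ∷ rs) c (c′ ∷ p) (β∉rs ∷ distinct) (β-root ∷ roots) |p|≡|rs| y = begin
      eval y (c ∷ c′ ∷ p)                              ≈⟨ eval-synthDiv y β c (c′ ∷ p) ⟩
      (y ⊖ ι β) ⊗ eval y (rem ∷ quot) ⊕ ι (c + β * rem) ≈⟨ +-cong (*-congˡ IH) (trans (reflexive (≡.cong ι rem≡0)) 0#-homo) ⟩
      (y ⊖ ι β) ⊗ (ι L ⊗ Π) ⊕ 𝟘                        ≈⟨ +-identityʳ _ ⟩
      (y ⊖ ι β) ⊗ (ι L ⊗ Π)                            ≈⟨ solve 3 (λ a b c → a :* (b :* c) := b :* (a :* c))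
                                                                  refl (y ⊖ ι β) (ι L) Π ⟩
      ι L ⊗ ((y ⊖ ι β) ⊗ Π)                            ∎
      where
      quot = proj₁ (synthDiv β c′ p)
      rem  = proj₂ (synthDiv β c′ p)
      L = cofactor rs rem quot
      Π = product (List.map (λ β → y ⊖ ι β) rs)
      rem≡0 = root⇒remainder≡0 β c (c′ ∷ p) β-root
      IH : eval y (rem ∷ quot) ≈ ι L ⊗ Π
      IH = factor-roots rs rem quot distinct
             (All.zipWith (λ (β≢x , x-root) → root⇒quotient-root β c (c′ ∷ p) _ β≢x rem≡0 x-root) (β∉rs , roots))
             (≡.trans (synthDiv-length β c′ p) (ℕ.suc-injective |p|≡|rs|)) y

module ScalarPowers {q″ : ℕ} (K : FiniteField (suc (suc q″))) where
  open Factorisation K public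
  open Fermat K using (fermat)
  open ≡ using (refl; cong; sym; trans)
  open Inverse enumeration using () renaming (to to index; from to element; strictlyInverseʳ to element-index; strictlyInverseˡ to index-element)

  q′ : ℕ
  q′ = suc q″

  nonzeroElements : List F
  nonzeroElements = List.tabulate (element ∘ punchIn (index 0#))

  nonzeroElements-≢0 : All (_≢ 0#) nonzeroElements
  nonzeroElements-≢0 = All.tabulate⁺ λ j e≡0 → Fin.punchInᵢ≢i (index 0#) j (trans (sym (index-element _)) (cong index e≡0))

  nonzeroElements-distinct : AllPairs _≢_ nonzeroElements
  nonzeroElements-distinct = Unique.tabulate⁺ λ {i} {j} eᵢ≡eⱼ →
    Fin.punchIn-injective (index 0#) i j (trans (sym (index-element _)) (trans (cong index eᵢ≡eⱼ) (index-element _)))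

  -- xᵉ-1 q′ unfolds to (0# + - 1#) ∷ xq′-1-tail
  xq′-1-tail : Poly
  xq′-1-tail = monomial q″ +ₚ []

  length-xq′-1-tail : length xq′-1-tail ≡ length nonzeroElements
  length-xq′-1-tail = trans (length-+ₚ[] (monomial q″))
                            (trans (length-monomial q″) (sym (List.length-tabulate (element ∘ punchIn (index 0#)))))
    where
    length-+ₚ[] : ∀ p → length (p +ₚ []) ≡ length p
    length-+ₚ[] []      = refl
    length-+ₚ[] (a ∷ p) = refl

  nonzeroElements-roots : All (λ β → FEval.eval β (xᵉ-1 q′) ≡ 0#) nonzeroElements
  nonzeroElements-roots = All.map (λ {β} β≢0 → trans (FEval.eval-xᵉ-1 β q′)
                                                      (trans (cong (_+ - 1#) (fermat β β≢0)) (F.-‿inverseʳ 1#)))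
                                  nonzeroElements-≢0

  module FFactor = Factor FRing (Identity.isRingHomomorphism F.rawRing refl)
  module PFactor = Factor PolyRing C-isScalarEmbedding

  L : F
  L = cofactor nonzeroElements (0# + - 1#) xq′-1-tail

  factor-xq′-1 : ∀ y → PFactor.eval y (xᵉ-1 q′) ≋ C L *ₚ PFactor.product (List.map (λ β → y -ₚ C β) nonzeroElements)
  factor-xq′-1 = PFactor.factor-roots nonzeroElements (0# + - 1#) xq′-1-tail
                                      nonzeroElements-distinct nonzeroElements-roots length-xq′-1-tail

  L≢0 : L ≢ 0#
  L≢0 L≡0 = 0≢1 (sym (trans (sym (FProp.-‿involutive 1#)) (trans (cong -_ -1≡0) FProp.-0#≈0#)))
    where
    open ≡.≡-Reasoning
    Π = FFactor.product (List.map (λ β → 0# + - β) nonzeroElements)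
    -1≡0 : - 1# ≡ 0#
    -1≡0 = begin
      - 1#                      ≡⟨ sym (F.+-identityˡ _) ⟩
      0# + - 1#                 ≡⟨ cong (_+ - 1#) (sym (F.zeroˡ (0# ^F q″))) ⟩
      0# ^F q′ + - 1#           ≡⟨ sym (FEval.eval-xᵉ-1 0# q′) ⟩
      FEval.eval 0# (xᵉ-1 q′)   ≡⟨ FFactor.factor-roots nonzeroElements (0# + - 1#) xq′-1-tail
                                     nonzeroElements-distinct nonzeroElements-roots length-xq′-1-tail 0# ⟩
      L * Π                     ≡⟨ cong (_* Π) L≡0 ⟩
      0# * Π                    ≡⟨ F.zeroˡ Π ⟩
      0#                        ∎

  module _ {h : Poly} {m : ℕ} (deg-h : Degree h m) (0<m : 0 < m) (irreducible : Irreducible h) where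
    ∣product⇒∣factor : ∀ a xs (f : F → Poly) → h ∣≋ a *ₚ PFactor.product (List.map f xs) →
                       h ∣≋ a ⊎ Any (λ β → h ∣≋ f β) xs
    ∣product⇒∣factor a []       f h∣a = inj₁ (∣≋-resp (P.*-identityʳ a) h∣a)
    ∣product⇒∣factor a (β ∷ xs) f h∣ =
      Sum.[ inj₂ ∘ here , Sum.map₂ there ∘ ∣product⇒∣factor a xs f ]′
        (irreducible⇒prime deg-h irreducible (f β) (a *ₚ Π) (∣≋-resp swap h∣))
      where
      open PSolver using (solve; _:*_; _:=_)
      Π = PFactor.product (List.map f xs)
      swap : a *ₚ (f β *ₚ Π) ≋ f β *ₚ (a *ₚ Π)
      swap = solve 3 (λ a b c → a :* (b :* c) := b :* (a :* c)) ≋-refl a (f β) Π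

    module _ {N : ℕ} (order : Order h N) where
      open Modulo h
      open OrderFacts order

      scalar⇒N∣ : ∀ {j α} → α ≢ 0# → monomial j ≈ₕ C α → N ℕ.∣ j ℕ.* q′
      scalar⇒N∣ {j} {α} α≢0 x^j≈α = monomial≈ₕ1⇒N∣
        (≈ₕ-resp (≋-sym (monomial-* j q′)) (≋-trans (C-^ₚ α q′) (∷-cong (fermat α α≢0) ≋-refl)) (^ₚ-≈ₕ q′ x^j≈α))

      -- h divides x^(j(q−1)) − 1 = L ∏_{β ≠ 0} (x^j − β), hence one of the factors.
      N∣⇒scalar : ∀ {j} → N ℕ.∣ j ℕ.* q′ → ∃ λ α → α ≢ 0# × monomial j ≈ₕ C α
      N∣⇒scalar {j} N∣jq′ = [ L-absurd , root ] (∣product⇒∣factor (C L) nonzeroElements (λ β → y -ₚ C β) h∣LΠ)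
        where
        y = monomial j
        h∣LΠ : h ∣≋ C L *ₚ PFactor.product (List.map (λ β → y -ₚ C β) nonzeroElements)
        h∣LΠ = ∣≋-resp (≋-trans (+ₚ-cong (monomial-* j q′) (≋-refl { -ₚ 1ₚ }))
                                (≋-trans (≋-sym (PFactor.eval-xᵉ-1 y q′)) (factor-xq′-1 y)))
                       (_≈ₕ_.h∣u-v (N∣⇒monomial≈ₕ1 N∣jq′))
        L-absurd : h ∣≋ C L → ∃ λ α → α ≢ 0# × y ≈ₕ C α
        L-absurd h∣L = ⊥-elim (L≢0 (∣C⇒≡0 deg-h 0<m h∣L))
        root : Any (λ β → h ∣≋ y -ₚ C β) nonzeroElements → ∃ λ α → α ≢ 0# × y ≈ₕ C α
        root h∣y-β = let (β≢0 , h∣) = All.lookupAny nonzeroElements-≢0 h∣y-β in Any.lookup h∣y-β , β≢0 , mk≈ₕ h∣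

module _ {A : Set} where
  open ≡ using (sym; trans; cong; subst)

  ≗-lookup⇒≡ : ∀ {k} (u v : Vec A k) → lookup u ≗ lookup v → u ≡ v
  ≗-lookup⇒≡ u v u≗v = trans (sym (Vec.tabulate∘lookup u)) (trans (Vec.tabulate-cong u≗v) (Vec.tabulate∘lookup v))

  lookup-∷ʳ-last : ∀ {k} (ys : Vec A k) y → lookup (ys ∷ʳ y) (fromℕ k) ≡ y
  lookup-∷ʳ-last []       y = ≡.refl
  lookup-∷ʳ-last (x ∷ ys) y = lookup-∷ʳ-last ys y

  lookup-∷ʳ-inject₁ : ∀ {k} (ys : Vec A k) y i → lookup (ys ∷ʳ y) (inject₁ i) ≡ lookup ys i
  lookup-∷ʳ-inject₁ (x ∷ ys) y Fin.zero    = ≡.refl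
  lookup-∷ʳ-inject₁ (x ∷ ys) y (Fin.suc i) = lookup-∷ʳ-inject₁ ys y i

  lookup-last : ∀ {k} (v : Vec A (suc k)) → Vec.last v ≡ lookup v (fromℕ k)
  lookup-last {k} v = let (ys , y , v≡ys∷ʳy) = Vec.initLast v in
    subst (λ w → Vec.last w ≡ lookup w (fromℕ k)) (sym v≡ys∷ʳy) (trans (Vec.last-∷ʳ y ys) (sym (lookup-∷ʳ-last ys y)))

  lookup-init : ∀ {k} (v : Vec A (suc k)) i → lookup (Vec.init v) i ≡ lookup v (inject₁ i)
  lookup-init {k} v i = let (ys , y , v≡ys∷ʳy) = Vec.initLast v in
    subst (λ w → lookup (Vec.init w) i ≡ lookup w (inject₁ i)) (sym v≡ys∷ʳy)
          (trans (cong (λ u → lookup u i) (Vec.init-∷ʳ y ys)) (sym (lookup-∷ʳ-inject₁ ys y i)))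

module QuotientRing {q : ℕ} (K : FiniteField q) (n′ : ℕ) where
  open Monomials K
  open ≡ using (refl; cong; cong₂; sym; trans)
  open ≡.≡-Reasoning

  n : ℕ
  n = suc n′

  0ᴬ : A n
  0ᴬ = zeroA n

  infixl 6 _⊞_
  _⊞_ : ∀ {k} → A k → A k → A k
  _⊞_ = Vec.zipWith _+_

  ⊞-identityˡ : ∀ {k} (v : A k) → zeroA k ⊞ v ≡ v
  ⊞-identityˡ []      = refl
  ⊞-identityˡ (x ∷ v) = cong₂ _∷_ (F.+-identityˡ x) (⊞-identityˡ v)

  ⊞-identityʳ : ∀ {k} (v : A k) → v ⊞ zeroA k ≡ v
  ⊞-identityʳ []      = refl
  ⊞-identityʳ (x ∷ v) = cong₂ _∷_ (F.+-identityʳ x) (⊞-identityʳ v)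

  •-zero : ∀ {k} c → c • zeroA k ≡ zeroA k
  •-zero c = trans (Vec.map-replicate (c *_) 0# _) (cong (Vec.replicate _) (F.zeroʳ c))

  predᶜ : Fin n → Fin n
  predᶜ Fin.zero    = fromℕ n′
  predᶜ (Fin.suc i) = inject₁ i

  lookup-mulX : ∀ (v : A n) i → lookup (mulX v) i ≡ lookup v (predᶜ i)
  lookup-mulX (a ∷ v) Fin.zero    = lookup-last (a ∷ v)
  lookup-mulX (a ∷ v) (Fin.suc i) = lookup-init (a ∷ v) i

  mulX-zipWith : ∀ (f : F → F → F) (u v : A n) → mulX (Vec.zipWith f u v) ≡ Vec.zipWith f (mulX u) (mulX v)
  mulX-zipWith f u v = ≗-lookup⇒≡ _ _ λ i → begin
    lookup (mulX (Vec.zipWith f u v)) i              ≡⟨ lookup-mulX (Vec.zipWith f u v) i ⟩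
    lookup (Vec.zipWith f u v) (predᶜ i)             ≡⟨ Vec.lookup-zipWith f (predᶜ i) u v ⟩
    f (lookup u (predᶜ i)) (lookup v (predᶜ i))      ≡⟨ sym (cong₂ f (lookup-mulX u i) (lookup-mulX v i)) ⟩
    f (lookup (mulX u) i) (lookup (mulX v) i)        ≡⟨ sym (Vec.lookup-zipWith f i (mulX u) (mulX v)) ⟩
    lookup (Vec.zipWith f (mulX u) (mulX v)) i       ∎

  mulX-map : ∀ (f : F → F) (v : A n) → mulX (Vec.map f v) ≡ Vec.map f (mulX v)
  mulX-map f v = ≗-lookup⇒≡ _ _ λ i → begin
    lookup (mulX (Vec.map f v)) i     ≡⟨ lookup-mulX (Vec.map f v) i ⟩
    lookup (Vec.map f v) (predᶜ i)    ≡⟨ Vec.lookup-map (predᶜ i) f v ⟩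
    f (lookup v (predᶜ i))            ≡⟨ sym (cong f (lookup-mulX v i)) ⟩
    f (lookup (mulX v) i)             ≡⟨ sym (Vec.lookup-map i f (mulX v)) ⟩
    lookup (Vec.map f (mulX v)) i     ∎

  mulX-0ᴬ : mulX 0ᴬ ≡ 0ᴬ
  mulX-0ᴬ = ≗-lookup⇒≡ _ _ λ i →
    trans (lookup-mulX 0ᴬ i) (trans (Vec.lookup-replicate (predᶜ i) 0#) (sym (Vec.lookup-replicate i 0#)))

  addAt0-⊞ : ∀ a b (u v : A n) → addAt0 (a + b) (u ⊞ v) ≡ addAt0 a u ⊞ addAt0 b v
  addAt0-⊞ a b (x ∷ u) (y ∷ v) =
    cong (_∷ u ⊞ v) (solve 4 (λ a b x y → (a :+ b) :+ (x :+ y) := (a :+ x) :+ (b :+ y)) refl a b x y)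
    where open FSolver using (solve; _:+_; _:=_)

  addAt0-• : ∀ c a (v : A n) → addAt0 (c * a) (c • v) ≡ c • addAt0 a v
  addAt0-• c a (x ∷ v) = cong (_∷ c • v) (sym (F.distribˡ c a x))

  addAt0-0# : ∀ (v : A n) → addAt0 0# v ≡ v
  addAt0-0# (x ∷ v) = cong (_∷ v) (F.+-identityˡ x)

  reduce-≋[] : ∀ {p} → p ≋ [] → reduce n p ≡ 0ᴬ
  reduce-≋[] {[]}    _      = refl
  reduce-≋[] {c ∷ p} c∷p≋0 = begin
    addAt0 c (mulX (reduce n p))  ≡⟨ cong₂ (λ c v → addAt0 c (mulX v)) (coeff-≡ c∷p≋0 0) (reduce-≋[] (∷≋[]⇒≋[] c∷p≋0)) ⟩
    addAt0 0# (mulX 0ᴬ)           ≡⟨ addAt0-0# (mulX 0ᴬ) ⟩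
    mulX 0ᴬ                       ≡⟨ mulX-0ᴬ ⟩
    0ᴬ                            ∎

  reduce-cong : ∀ {p r} → p ≋ r → reduce n p ≡ reduce n r
  reduce-cong {[]}    {r}     p≋r = sym (reduce-≋[] (≋-sym p≋r))
  reduce-cong {a ∷ p} {[]}    p≋r = reduce-≋[] p≋r
  reduce-cong {a ∷ p} {b ∷ r} p≋r = cong₂ (λ c v → addAt0 c (mulX v)) (coeff-≡ p≋r 0) (reduce-cong (∷-tail p≋r))

  reduce-+ₚ : ∀ p r → reduce n (p +ₚ r) ≡ reduce n p ⊞ reduce n r
  reduce-+ₚ []      r       = sym (⊞-identityˡ _)
  reduce-+ₚ (a ∷ p) []      = sym (⊞-identityʳ _)
  reduce-+ₚ (a ∷ p) (b ∷ r) = begin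
    addAt0 (a + b) (mulX (reduce n (p +ₚ r)))                 ≡⟨ cong (addAt0 (a + b) ∘ mulX) (reduce-+ₚ p r) ⟩
    addAt0 (a + b) (mulX (reduce n p ⊞ reduce n r))           ≡⟨ cong (addAt0 (a + b)) (mulX-zipWith _+_ _ _) ⟩
    addAt0 (a + b) (mulX (reduce n p) ⊞ mulX (reduce n r))    ≡⟨ addAt0-⊞ a b _ _ ⟩
    reduce n (a ∷ p) ⊞ reduce n (b ∷ r)                       ∎

  reduce-scaleₚ : ∀ c p → reduce n (scaleₚ c p) ≡ c • reduce n p
  reduce-scaleₚ c []      = sym (•-zero c)
  reduce-scaleₚ c (a ∷ p) = begin
    addAt0 (c * a) (mulX (reduce n (scaleₚ c p)))   ≡⟨ cong (addAt0 (c * a) ∘ mulX) (reduce-scaleₚ c p) ⟩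
    addAt0 (c * a) (mulX (c • reduce n p))          ≡⟨ cong (addAt0 (c * a)) (mulX-map (c *_) _) ⟩
    addAt0 (c * a) (c • mulX (reduce n p))          ≡⟨ addAt0-• c a _ ⟩
    c • reduce n (a ∷ p)                            ∎

  reduce-shift : ∀ p → reduce n (0# ∷ p) ≡ mulX (reduce n p)
  reduce-shift p = addAt0-0# (mulX (reduce n p))

  mulXPow-reduce : ∀ j p → mulXPow j (reduce n p) ≡ reduce n (monomial j *ₚ p)
  mulXPow-reduce zero    p = reduce-cong (≋-sym (*ₚ-identityˡ p))
  mulXPow-reduce (suc j) p = begin
    mulX (mulXPow j (reduce n p))         ≡⟨ cong mulX (mulXPow-reduce j p) ⟩
    mulX (reduce n (monomial j *ₚ p))     ≡⟨ sym (reduce-shift (monomial j *ₚ p)) ⟩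
    reduce n (0# ∷ monomial j *ₚ p)       ≡⟨ reduce-cong (≋-sym (*ₚ-shiftˡ (monomial j) p)) ⟩
    reduce n (monomial (suc j) *ₚ p)      ∎

  •-reduce : ∀ α p → α • reduce n p ≡ reduce n (C α *ₚ p)
  •-reduce α p = trans (sym (reduce-scaleₚ α p)) (reduce-cong (scaleₚ≋C* α p))

  lookup-reduce-zero : ∀ c p → lookup (reduce n (c ∷ p)) Fin.zero ≡ c + lookup (reduce n p) (fromℕ n′)
  lookup-reduce-zero c p with mulX (reduce n p) | lookup-mulX (reduce n p) Fin.zero
  ... | x ∷ _ | x≡ = cong (c +_) x≡

  lookup-reduce-suc : ∀ c p i → lookup (reduce n (c ∷ p)) (Fin.suc i) ≡ lookup (reduce n p) (inject₁ i)
  lookup-reduce-suc c p i with mulX (reduce n p) | lookup-mulX (reduce n p) (Fin.suc i)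
  ... | _ ∷ _ | xᵢ≡ = xᵢ≡

  lookup-reduce-DegreeBelow : ∀ r → DegreeBelow n r → ∀ i → lookup (reduce n r) i ≡ coeff r (toℕ i)
  lookup-reduce-DegreeBelow []      _   i           = Vec.lookup-replicate i 0#
  lookup-reduce-DegreeBelow (c ∷ r) c∷r<n Fin.zero    = begin
    lookup (reduce n (c ∷ r)) Fin.zero         ≡⟨ lookup-reduce-zero c r ⟩
    c + lookup (reduce n r) (fromℕ n′)         ≡⟨ cong (c +_) (lookup-reduce-DegreeBelow r (DegreeBelow-tail c∷r<n) (fromℕ n′)) ⟩
    c + coeff r (toℕ (fromℕ n′))               ≡⟨ cong (λ k → c + coeff r k) (Fin.toℕ-fromℕ n′) ⟩
    c + coeff r n′                             ≡⟨ cong (c +_) (c∷r<n n ℕ.≤-refl) ⟩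
    c + 0#                                     ≡⟨ F.+-identityʳ c ⟩
    c                                          ∎
  lookup-reduce-DegreeBelow (c ∷ r) c∷r<n (Fin.suc i) = begin
    lookup (reduce n (c ∷ r)) (Fin.suc i)      ≡⟨ lookup-reduce-suc c r i ⟩
    lookup (reduce n r) (inject₁ i)            ≡⟨ lookup-reduce-DegreeBelow r (DegreeBelow-tail c∷r<n) (inject₁ i) ⟩
    coeff r (toℕ (inject₁ i))                  ≡⟨ cong (coeff r) (Fin.toℕ-inject₁ i) ⟩
    coeff r (toℕ i)                            ∎

  reduce-monomial[n] : reduce n (monomial n) ≡ reduce n 1ₚ
  reduce-monomial[n] = ≗-lookup⇒≡ _ _ λ
    { Fin.zero → begin
        lookup (reduce n (monomial n)) Fin.zero          ≡⟨ lookup-reduce-zero 0# (monomial n′) ⟩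
        0# + lookup (reduce n (monomial n′)) (fromℕ n′)  ≡⟨ cong (0# +_) (x^n′-coeff (fromℕ n′)) ⟩
        0# + coeff (monomial n′) (toℕ (fromℕ n′))        ≡⟨ cong (λ k → 0# + coeff (monomial n′) k) (Fin.toℕ-fromℕ n′) ⟩
        0# + coeff (monomial n′) n′                      ≡⟨ trans (F.+-identityˡ _) (coeff-monomial n′) ⟩
        1#                                               ≡⟨ sym (lookup-reduce-DegreeBelow 1ₚ 1ₚ<n Fin.zero) ⟩
        lookup (reduce n 1ₚ) Fin.zero                    ∎
    ; (Fin.suc i) → begin
        lookup (reduce n (monomial n)) (Fin.suc i)       ≡⟨ lookup-reduce-suc 0# (monomial n′) i ⟩
        lookup (reduce n (monomial n′)) (inject₁ i)      ≡⟨ x^n′-coeff (inject₁ i) ⟩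
        coeff (monomial n′) (toℕ (inject₁ i))            ≡⟨ coeff-monomial-< n′ (≡.subst (ℕ._< n′) (sym (Fin.toℕ-inject₁ i)) (Fin.toℕ<n i)) ⟩
        0#                                               ≡⟨ sym (lookup-reduce-DegreeBelow 1ₚ 1ₚ<n (Fin.suc i)) ⟩
        lookup (reduce n 1ₚ) (Fin.suc i)                 ∎ }
    where
    x^n′-coeff : ∀ i → lookup (reduce n (monomial n′)) i ≡ coeff (monomial n′) (toℕ i)
    x^n′-coeff = lookup-reduce-DegreeBelow (monomial n′) (Degree⇒DegreeBelow (monomial n′) (Degree-monomial n′))
    1ₚ<n : DegreeBelow n 1ₚ
    1ₚ<n = DegreeBelow-mono {p = 1ₚ} (s≤s ℕ.z≤n) (Degree⇒DegreeBelow 1ₚ (Degree-monomial 0))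

  reduce-xⁿ-1 : reduce n (xᵉ-1 n) ≡ 0ᴬ
  reduce-xⁿ-1 = begin
    reduce n (monomial n +ₚ (- 1# ∷ []))             ≡⟨ reduce-+ₚ (monomial n) (- 1# ∷ []) ⟩
    reduce n (monomial n) ⊞ reduce n (- 1# ∷ [])     ≡⟨ cong (_⊞ reduce n (- 1# ∷ [])) reduce-monomial[n] ⟩
    reduce n 1ₚ ⊞ reduce n (- 1# ∷ [])               ≡⟨ sym (reduce-+ₚ 1ₚ (- 1# ∷ [])) ⟩
    reduce n ((1# + - 1#) ∷ [])                      ≡⟨ reduce-≋[] (≋-trans (∷-cong (F.-‿inverseʳ 1#) ≋-refl) 0∷[]≋[]) ⟩
    0ᴬ                                               ∎

  reduce-*ₚ-xⁿ-1 : ∀ t → reduce n (t *ₚ xᵉ-1 n) ≡ 0ᴬ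
  reduce-*ₚ-xⁿ-1 []      = refl
  reduce-*ₚ-xⁿ-1 (c ∷ t) = begin
    reduce n (scaleₚ c (xᵉ-1 n) +ₚ (0# ∷ t *ₚ xᵉ-1 n))                 ≡⟨ reduce-+ₚ (scaleₚ c (xᵉ-1 n)) (0# ∷ t *ₚ xᵉ-1 n) ⟩
    reduce n (scaleₚ c (xᵉ-1 n)) ⊞ reduce n (0# ∷ t *ₚ xᵉ-1 n)         ≡⟨ cong₂ _⊞_ scaled shifted ⟩
    0ᴬ ⊞ 0ᴬ                                                            ≡⟨ ⊞-identityˡ 0ᴬ ⟩
    0ᴬ                                                                 ∎
    where
    scaled : reduce n (scaleₚ c (xᵉ-1 n)) ≡ 0ᴬ
    scaled = trans (reduce-scaleₚ c (xᵉ-1 n)) (trans (cong (c •_) reduce-xⁿ-1) (•-zero c))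
    shifted : reduce n (0# ∷ t *ₚ xᵉ-1 n) ≡ 0ᴬ
    shifted = trans (reduce-shift (t *ₚ xᵉ-1 n)) (trans (cong mulX (reduce-*ₚ-xⁿ-1 t)) mulX-0ᴬ)

  xⁿ-1∣⇒reduce≡0 : ∀ {p} → xᵉ-1 n ∣≋ p → reduce n p ≡ 0ᴬ
  xⁿ-1∣⇒reduce≡0 (divides t xⁿ-1*t≋p) = trans (reduce-cong (≋-trans (≋-sym xⁿ-1*t≋p) (*ₚ-comm _ t))) (reduce-*ₚ-xⁿ-1 t)

  reduce≡0⇒xⁿ-1∣ : ∀ {p} → reduce n p ≡ 0ᴬ → xᵉ-1 n ∣≋ p
  reduce≡0⇒xⁿ-1∣ {p} p↦0 = from-division (divMod (Degree-xᵉ-1 n′) p)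
    where
    from-division : DivisionBy (xᵉ-1 n) n p → xᵉ-1 n ∣≋ p
    from-division (division Q r p≋Qxⁿ-1+r r<n) = divides Q (≋-trans (*ₚ-comm _ Q)
      (≋-trans (≋-sym (+ₚ-identityʳ _)) (≋-trans (+ₚ-cong (≋-refl {Q *ₚ xᵉ-1 n}) (≋-sym r≋0)) (≋-sym p≋Qxⁿ-1+r))))
      where
      r↦0 : reduce n r ≡ 0ᴬ
      r↦0 = begin
        reduce n r                               ≡⟨ sym (⊞-identityˡ _) ⟩
        0ᴬ ⊞ reduce n r                          ≡⟨ cong (_⊞ reduce n r) (sym (reduce-*ₚ-xⁿ-1 Q)) ⟩
        reduce n (Q *ₚ xᵉ-1 n) ⊞ reduce n r      ≡⟨ sym (reduce-+ₚ (Q *ₚ xᵉ-1 n) r) ⟩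
        reduce n (Q *ₚ xᵉ-1 n +ₚ r)              ≡⟨ reduce-cong (≋-sym p≋Qxⁿ-1+r) ⟩
        reduce n p                               ≡⟨ p↦0 ⟩
        0ᴬ                                       ∎
      r≋0 : r ≋ []
      r≋0 = mk λ j → case j (j ℕ.<? n)
        where
        case : ∀ j → Dec (j < n) → coeff r j ≡ 0#
        case j (yes j<n) = begin
          coeff r j                          ≡⟨ cong (coeff r) (sym (Fin.toℕ-fromℕ< j<n)) ⟩
          coeff r (toℕ (fromℕ< j<n))         ≡⟨ sym (lookup-reduce-DegreeBelow r r<n (fromℕ< j<n)) ⟩
          lookup (reduce n r) (fromℕ< j<n)   ≡⟨ cong (λ v → lookup v (fromℕ< j<n)) r↦0 ⟩
          lookup 0ᴬ (fromℕ< j<n)             ≡⟨ Vec.lookup-replicate (fromℕ< j<n) 0# ⟩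
          0#                                 ∎
        case j (no j≮n)  = r<n j (ℕ.≮⇒≥ j≮n)

  reduce≡⇒xⁿ-1∣- : ∀ {p r} → reduce n p ≡ reduce n r → xᵉ-1 n ∣≋ p -ₚ r
  reduce≡⇒xⁿ-1∣- {p} {r} p≡r = reduce≡0⇒xⁿ-1∣ (begin
    reduce n (p -ₚ r)                  ≡⟨ reduce-+ₚ p (-ₚ r) ⟩
    reduce n p ⊞ reduce n (-ₚ r)       ≡⟨ cong (_⊞ reduce n (-ₚ r)) p≡r ⟩
    reduce n r ⊞ reduce n (-ₚ r)       ≡⟨ sym (reduce-+ₚ r (-ₚ r)) ⟩
    reduce n (r -ₚ r)                  ≡⟨ reduce-≋[] (P.-‿inverseʳ r) ⟩
    0ᴬ                                 ∎)

  xⁿ-1∣-⇒reduce≡ : ∀ {p r} → xᵉ-1 n ∣≋ p -ₚ r → reduce n p ≡ reduce n r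
  xⁿ-1∣-⇒reduce≡ {p} {r} xⁿ-1∣p-r = begin
    reduce n p                         ≡⟨ reduce-cong (PSolver.solve 2 (λ p r → p PSolver.:= (p PSolver.:- r) PSolver.:+ r) ≋-refl p r) ⟩
    reduce n ((p -ₚ r) +ₚ r)           ≡⟨ reduce-+ₚ (p -ₚ r) r ⟩
    reduce n (p -ₚ r) ⊞ reduce n r     ≡⟨ cong (_⊞ reduce n r) (xⁿ-1∣⇒reduce≡0 xⁿ-1∣p-r) ⟩
    0ᴬ ⊞ reduce n r                    ≡⟨ ⊞-identityˡ (reduce n r) ⟩
    reduce n r                         ∎

m*n≡m%d*n+m/d*[d*n] : ∀ m n d .{{_ : NonZero d}} → m ℕ.* n ≡ m % d ℕ.* n ℕ.+ m / d ℕ.* (d ℕ.* n)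
m*n≡m%d*n+m/d*[d*n] m n d = begin
  m ℕ.* n                                 ≡⟨ ≡.cong (ℕ._* n) (m≡m%n+[m/n]*n m d) ⟩
  (m % d ℕ.+ m / d ℕ.* d) ℕ.* n           ≡⟨ ℕ.*-distribʳ-+ n (m % d) (m / d ℕ.* d) ⟩
  m % d ℕ.* n ℕ.+ m / d ℕ.* d ℕ.* n       ≡⟨ ≡.cong (m % d ℕ.* n ℕ.+_) (ℕ.*-assoc (m / d) d n) ⟩
  m % d ℕ.* n ℕ.+ m / d ℕ.* (d ℕ.* n)     ∎
  where open ≡.≡-Reasoning

gcd-nonZeroʳ : ∀ m n .{{_ : NonZero n}} → NonZero (gcd m n)
gcd-nonZeroʳ m n = ℕ.≢-nonZero (gcd[m,n]≢0 m n (inj₂ (ℕ.≢-nonZero⁻¹ n)))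

module _ (N k : ℕ) .{{_ : NonZero k}} where
  private instance
    gcd≢0 : NonZero (gcd N k)
    gcd≢0 = gcd-nonZeroʳ N k

  -- With g = gcd N k: N ∣ t k ⇔ N / g ∣ t (k / g), and N / g is coprime to k / g.
  ∣*⇔/gcd∣ : ∀ t → N ∣ t ℕ.* k ⇔ N / gcd N k ∣ t
  ∣*⇔/gcd∣ t = mk⇔ to from
    where
    g = gcd N k
    N≡ : N / g ℕ.* g ≡ N
    N≡ = m/n*n≡m (gcd[m,n]∣m N k)
    k≡ : k / g ℕ.* g ≡ k
    k≡ = m/n*n≡m (gcd[m,n]∣n N k)
    to : N ∣ t ℕ.* k → N / g ∣ t
    to N∣tk = coprime-divisor (coprime-/gcd N k) (≡.subst (N / g ∣_) (ℕ.*-comm t (k / g))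
                (*-cancelʳ-∣ g (≡.subst₂ _∣_ (≡.sym N≡)
                                         (≡.trans (≡.cong (t ℕ.*_) (≡.sym k≡)) (≡.sym (ℕ.*-assoc t (k / g) g))) N∣tk)))
    from : N / g ∣ t → N ∣ t ℕ.* k
    from N/g∣t = ≡.subst (_∣ t ℕ.* k) N≡ (∣-trans (*-monoˡ-∣ g N/g∣t) (*-monoʳ-∣ t (gcd[m,n]∣n N k)))

module Cycles {q″ : ℕ} (K : FiniteField (suc (suc q″))) (n′ : ℕ) where
  open ScalarPowers K public
  open QuotientRing K n′ using (n; 0ᴬ; reduce-cong; mulXPow-reduce; •-reduce; xⁿ-1∣⇒reduce≡0; reduce≡⇒xⁿ-1∣-; xⁿ-1∣-⇒reduce≡)
  open ≡ using (refl; cong; sym; trans)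

  classesPerCycle elementsPerClass : ℕ → ℕ
  classesPerCycle N  = _/_ N (gcd N q′) {{gcd-nonZeroʳ N q′}}
  elementsPerClass N = gcd N q′

  module _ {h g : Poly} {m N : ℕ} (deg-h : Degree h m) (0<m : 0 < m) (irreducible : Irreducible h)
           (order : Order h N) (gh≈xⁿ-1 : g *ₚ h ≈ₚ xᵉ-1 n) (a : Poly) (z≢0 : reduce n (a *ₚ g) ≢ 0ᴬ) where
    open Modulo h
    open OrderFacts order
    open PSolver using (solve; _:+_; _:*_; _:-_; _:=_)

    z : A n
    z = reduce n (a *ₚ g)

    gh≋xⁿ-1 : g *ₚ h ≋ xᵉ-1 n
    gh≋xⁿ-1 = mk gh≈xⁿ-1

    deg-g : ∃ (Degree g)
    deg-g = [ g≋0-absurd , (λ deg → deg) ]′ (≋[]⊎Degree g)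
      where
      g≋0-absurd : g ≋ [] → ∃ (Degree g)
      g≋0-absurd g≋0 = ⊥-elim (proj₁ (Degree-xᵉ-1 n′) (coeff-≡ (≋-trans (≋-sym gh≋xⁿ-1) (*ₚ-zeroˡ h g≋0)) n))

    h∤a : ¬ h ∣≋ a
    h∤a (divides t ht≋a) = z≢0 (xⁿ-1∣⇒reduce≡0 (divides t (begin
      xᵉ-1 n *ₚ t        ≈⟨ *ₚ-congʳ t (≋-sym gh≋xⁿ-1) ⟩
      (g *ₚ h) *ₚ t      ≈⟨ solve 3 (λ g h t → (g :* h) :* t := (h :* t) :* g) ≋-refl g h t ⟩
      (h *ₚ t) *ₚ g      ≈⟨ *ₚ-congʳ g ht≋a ⟩
      a *ₚ g             ∎)))
      where open ≋-Reasoning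

    -- u ↦ u z identifies K[x]/(h) with the minimal ideal.
    reduce-*z≡⇔≈ₕ : ∀ u v → reduce n (u *ₚ (a *ₚ g)) ≡ reduce n (v *ₚ (a *ₚ g)) ⇔ u ≈ₕ v
    reduce-*z≡⇔≈ₕ u v = mk⇔ to from
      where
      open ≋-Reasoning
      to : reduce n (u *ₚ (a *ₚ g)) ≡ reduce n (v *ₚ (a *ₚ g)) → u ≈ₕ v
      to uz≡vz = [ mk≈ₕ , ⊥-elim ∘ h∤a ]′ (irreducible⇒prime deg-h irreducible (u -ₚ v) a (divides t ht≋[u-v]a))
        where
        xⁿ-1∣ : xᵉ-1 n ∣≋ u *ₚ (a *ₚ g) -ₚ v *ₚ (a *ₚ g)
        xⁿ-1∣ = reduce≡⇒xⁿ-1∣- {u *ₚ (a *ₚ g)} {v *ₚ (a *ₚ g)} uz≡vz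
        t = _∣≋_.quotient xⁿ-1∣
        ht≋[u-v]a : h *ₚ t ≋ (u -ₚ v) *ₚ a
        ht≋[u-v]a = *ₚ-cancelˡ g (proj₂ deg-g) (begin
          g *ₚ (h *ₚ t)                        ≈⟨ ≋-sym (*ₚ-assoc g h t) ⟩
          (g *ₚ h) *ₚ t                        ≈⟨ *ₚ-congʳ t gh≋xⁿ-1 ⟩
          xᵉ-1 n *ₚ t                          ≈⟨ _∣≋_.f*q≋p xⁿ-1∣ ⟩
          u *ₚ (a *ₚ g) -ₚ v *ₚ (a *ₚ g)       ≈⟨ solve 4 (λ u v a g → u :* (a :* g) :- v :* (a :* g) := g :* ((u :- v) :* a))
                                                         ≋-refl u v a g ⟩
          g *ₚ ((u -ₚ v) *ₚ a)                 ∎)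
      from : u ≈ₕ v → reduce n (u *ₚ (a *ₚ g)) ≡ reduce n (v *ₚ (a *ₚ g))
      from (mk≈ₕ (divides t ht≋u-v)) = xⁿ-1∣-⇒reduce≡ {u *ₚ (a *ₚ g)} {v *ₚ (a *ₚ g)} (divides (t *ₚ a) (begin
        xᵉ-1 n *ₚ (t *ₚ a)                   ≈⟨ *ₚ-congʳ (t *ₚ a) (≋-sym gh≋xⁿ-1) ⟩
        (g *ₚ h) *ₚ (t *ₚ a)                 ≈⟨ solve 4 (λ g h t a → (g :* h) :* (t :* a) := (h :* t) :* (a :* g)) ≋-refl g h t a ⟩
        (h *ₚ t) *ₚ (a *ₚ g)                 ≈⟨ *ₚ-congʳ (a *ₚ g) ht≋u-v ⟩
        (u -ₚ v) *ₚ (a *ₚ g)                 ≈⟨ solve 3 (λ u v w → (u :- v) :* w := u :* w :- v :* w) ≋-refl u v (a *ₚ g) ⟩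
        u *ₚ (a *ₚ g) -ₚ v *ₚ (a *ₚ g)       ∎))

    cycle : ℕ → A n
    cycle j = mulXPow j z

    cycle≡•cycle⇔ : ∀ j k α → cycle j ≡ α • cycle k ⇔ monomial j ≈ₕ C α *ₚ monomial k
    cycle≡•cycle⇔ j k α = mk⇔ (λ e → to (trans (sym (mulXPow-reduce j (a *ₚ g))) (trans e α•cycle)))
                              (λ x^j≈αx^k → trans (mulXPow-reduce j (a *ₚ g)) (trans (from x^j≈αx^k) (sym α•cycle)))
      where
      open Equivalence (reduce-*z≡⇔≈ₕ (monomial j) (C α *ₚ monomial k))
      α•cycle : α • cycle k ≡ reduce n ((C α *ₚ monomial k) *ₚ (a *ₚ g))
      α•cycle = trans (cong (α •_) (mulXPow-reduce k (a *ₚ g)))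
                      (trans (•-reduce α (monomial k *ₚ (a *ₚ g))) (reduce-cong (≋-sym (*ₚ-assoc (C α) (monomial k) (a *ₚ g)))))

    private
      r d : ℕ
      r = classesPerCycle N
      d = elementsPerClass N

    private instance
      N≢0 : NonZero N
      N≢0 = ℕ.>-nonZero (proj₁ (proj₂ order))
      d≢0 : NonZero d
      d≢0 = gcd-nonZeroʳ N q′

    -- x is a unit modulo h: x^(kN) ≈ₕ 1.
    monomial-+-≈ₕ⇔ : ∀ k t w → monomial (k ℕ.+ t) ≈ₕ w *ₚ monomial k ⇔ monomial t ≈ₕ w
    monomial-+-≈ₕ⇔ k t w = mk⇔ to from
      where
      open ≈ₕ-Reasoning
      kN = k ℕ.* N
      s = kN ℕ.∸ k
      s+k≡kN : s ℕ.+ k ≡ kN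
      s+k≡kN = ℕ.m∸n+n≡m (ℕ.m≤m*n k N)
      x^kN≈1 : monomial kN ≈ₕ 1ₚ
      x^kN≈1 = N∣⇒monomial≈ₕ1 (n∣m*n k)
      to : monomial (k ℕ.+ t) ≈ₕ w *ₚ monomial k → monomial t ≈ₕ w
      to x^[k+t]≈wx^k = begin
        monomial t                          ≈⟨ ≋⇒≈ₕ (≋-sym (*ₚ-identityˡ _)) ⟩
        1ₚ *ₚ monomial t                    ≈⟨ *ₚ-≈ₕ (≈ₕ-sym x^kN≈1) (≈ₕ-refl {monomial t}) ⟩
        monomial kN *ₚ monomial t           ≈⟨ ≋⇒≈ₕ (≋-sym (monomial-+ kN t)) ⟩
        monomial (kN ℕ.+ t)                 ≈⟨ ≋⇒≈ₕ (monomial-cong (trans (cong (ℕ._+ t) (sym s+k≡kN)) (ℕ.+-assoc s k t))) ⟩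
        monomial (s ℕ.+ (k ℕ.+ t))          ≈⟨ ≋⇒≈ₕ (monomial-+ s (k ℕ.+ t)) ⟩
        monomial s *ₚ monomial (k ℕ.+ t)    ≈⟨ *ₚ-≈ₕ (≈ₕ-refl {monomial s}) x^[k+t]≈wx^k ⟩
        monomial s *ₚ (w *ₚ monomial k)     ≈⟨ ≋⇒≈ₕ (solve 3 (λ u w v → u :* (w :* v) := w :* (u :* v))
                                                             ≋-refl (monomial s) w (monomial k)) ⟩
        w *ₚ (monomial s *ₚ monomial k)     ≈⟨ ≋⇒≈ₕ (*ₚ-congˡ w (≋-trans (≋-sym (monomial-+ s k)) (monomial-cong s+k≡kN))) ⟩
        w *ₚ monomial kN                    ≈⟨ *ₚ-≈ₕ (≈ₕ-refl {w}) x^kN≈1 ⟩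
        w *ₚ 1ₚ                             ≈⟨ ≋⇒≈ₕ (P.*-identityʳ w) ⟩
        w                                   ∎
      from : monomial t ≈ₕ w → monomial (k ℕ.+ t) ≈ₕ w *ₚ monomial k
      from x^t≈w = begin
        monomial (k ℕ.+ t)           ≈⟨ ≋⇒≈ₕ (monomial-+ k t) ⟩
        monomial k *ₚ monomial t     ≈⟨ *ₚ-≈ₕ (≈ₕ-refl {monomial k}) x^t≈w ⟩
        monomial k *ₚ w              ≈⟨ ≋⇒≈ₕ (*ₚ-comm (monomial k) w) ⟩
        w *ₚ monomial k              ∎


    proportional⇔ : ∀ k t → Proportional (cycle (k ℕ.+ t)) (cycle k) ⇔ r ∣ t
    proportional⇔ k t = mk⇔ to from
      where
      to : Proportional (cycle (k ℕ.+ t)) (cycle k) → r ∣ t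
      to (α , α≢0 , x^[k+t]z≡αx^kz) = Equivalence.to (∣*⇔/gcd∣ N q′ t)
        (scalar⇒N∣ deg-h 0<m irreducible order α≢0
          (Equivalence.to (monomial-+-≈ₕ⇔ k t (C α)) (Equivalence.to (cycle≡•cycle⇔ (k ℕ.+ t) k α) x^[k+t]z≡αx^kz)))
      from : r ∣ t → Proportional (cycle (k ℕ.+ t)) (cycle k)
      from r∣t = let (α , α≢0 , x^t≈α) = N∣⇒scalar deg-h 0<m irreducible order (Equivalence.from (∣*⇔/gcd∣ N q′ t) r∣t) in
        α , α≢0 , Equivalence.from (cycle≡•cycle⇔ (k ℕ.+ t) k α) (Equivalence.from (monomial-+-≈ₕ⇔ k t (C α)) x^t≈α)

    cycle-+≡⇔ : ∀ k t → cycle (k ℕ.+ t) ≡ cycle k ⇔ N ∣ t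
    cycle-+≡⇔ k t = mk⇔
      (λ x^[k+t]z≡x^kz → monomial≈ₕ1⇒N∣ (Equivalence.to (monomial-+-≈ₕ⇔ k t 1ₚ)
        (Equivalence.to (cycle≡•cycle⇔ (k ℕ.+ t) k 1#) (trans x^[k+t]z≡x^kz (sym (1•v≡v (cycle k)))))))
      (λ N∣t → trans (Equivalence.from (cycle≡•cycle⇔ (k ℕ.+ t) k 1#)
        (Equivalence.from (monomial-+-≈ₕ⇔ k t 1ₚ) (N∣⇒monomial≈ₕ1 N∣t))) (1•v≡v (cycle k)))
      where
      1•v≡v : ∀ (v : A n) → 1# • v ≡ v
      1•v≡v v = trans (Vec.map-cong F.*-identityˡ v) (Vec.map-id v)

    private instance
      r≢0 : NonZero r
      r≢0 = ℕ.≢-nonZero (m/gcd[m,n]≢0 N q′)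

    d*r≡N : d ℕ.* r ≡ N
    d*r≡N = trans (ℕ.*-comm d r) (m/n*n≡m (gcd[m,n]∣m N q′))

    proportional-sym : ∀ {u v : A n} → Proportional u v → Proportional v u
    proportional-sym {u} {v} (α , α≢0 , u≡αv) = α⁻¹ , ⁻¹≢0 α α≢0 , (begin
      v                                ≡⟨ sym (Vec.map-id v) ⟩
      Vec.map id v                     ≡⟨ Vec.map-cong (λ x → trans (sym (F.*-identityˡ x)) (cong (_* x) (sym (*-inverseˡ α α≢0)))) v ⟩
      Vec.map ((α⁻¹ * α) *_) v         ≡⟨ Vec.map-cong (F.*-assoc α⁻¹ α) v ⟩
      Vec.map ((α⁻¹ *_) ∘ (α *_)) v    ≡⟨ Vec.map-∘ (α⁻¹ *_) (α *_) v ⟩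
      α⁻¹ • (α • v)                    ≡⟨ cong (α⁻¹ •_) (sym u≡αv) ⟩
      α⁻¹ • u                          ∎)
      where
      open ≡.≡-Reasoning
      α⁻¹ = α ⁻¹⟨ α≢0 ⟩

    numClasses-cycle : NumClasses z r
    numClasses-cycle = applyUpTo cycle r , List.length-applyUpTo cycle r , All.applyUpTo⁺₂ cycle r (λ i → i , refl)
               , AllPairs.applyUpTo⁺₁ cycle r non-proportional , covered
      where
      non-proportional : ∀ {i j} → i < j → j < r → ¬ Proportional (cycle i) (cycle j)
      non-proportional {i} {j} i<j j<r cᵢ∝cⱼ =
        >⇒∤ {{ℕ.>-nonZero (ℕ.m<n⇒0<n∸m i<j)}} (ℕ.≤-<-trans (ℕ.m∸n≤m j i) j<r) r∣j-i
        where
        r∣j-i : r ∣ j ℕ.∸ i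
        r∣j-i = Equivalence.to (proportional⇔ i (j ℕ.∸ i))
                  (≡.subst (λ l → Proportional (cycle l) (cycle i)) (sym (ℕ.m+[n∸m]≡n (ℕ.<⇒≤ i<j))) (proportional-sym cᵢ∝cⱼ))
      covered : ∀ w → InCycle z w → Any (Proportional w) (applyUpTo cycle r)
      covered w (j , w≡cⱼ) = Any.applyUpTo⁺ cycle (α , α≢0 , trans w≡cⱼ (trans (cong cycle (m≡m%n+[m/n]*n j r)) e)) (m%n<n j r)
        where
        α∝ = Equivalence.from (proportional⇔ (j % r) (j / r ℕ.* r)) (n∣m*n (j / r))
        α = proj₁ α∝
        α≢0 = proj₁ (proj₂ α∝)
        e = proj₂ (proj₂ α∝)

    classSize-cycle : ClassSize z d
    classSize-cycle = applyUpTo (cycle ∘ (ℕ._* r)) d , List.length-applyUpTo _ d , distinct , λ w → mk⇔ (member⇒ w) (member⇐ w)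
      where
      distinct : AllPairs _≢_ (applyUpTo (cycle ∘ (ℕ._* r)) d)
      distinct = AllPairs.applyUpTo⁺₁ _ d λ {i} {j} i<j j<d cᵢᵣ≡cⱼᵣ →
        >⇒∤ {{ℕ.m*n≢0 (j ℕ.∸ i) r {{ℕ.>-nonZero (ℕ.m<n⇒0<n∸m i<j)}}}}
          (ℕ.≤-<-trans (ℕ.*-monoˡ-≤ r (ℕ.m∸n≤m j i)) (≡.subst (j ℕ.* r <_) d*r≡N (ℕ.*-monoˡ-< r j<d)))
          (Equivalence.to (cycle-+≡⇔ (i ℕ.* r) ((j ℕ.∸ i) ℕ.* r))
            (trans (cong cycle (trans (sym (ℕ.*-distribʳ-+ r i (j ℕ.∸ i))) (cong (ℕ._* r) (ℕ.m+[n∸m]≡n (ℕ.<⇒≤ i<j)))))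
                   (sym cᵢᵣ≡cⱼᵣ)))
      member⇒ : ∀ w → w ∈ applyUpTo (cycle ∘ (ℕ._* r)) d → InCycle z w × Proportional w z
      member⇒ w w∈ = let (i , _ , w≡cᵢᵣ) = ∈-applyUpTo⁻ (cycle ∘ (ℕ._* r)) w∈
                         (α , α≢0 , e) = Equivalence.from (proportional⇔ 0 (i ℕ.* r)) (n∣m*n i)
                     in (i ℕ.* r , w≡cᵢᵣ) , α , α≢0 , trans w≡cᵢᵣ e
      member⇐ : ∀ w → InCycle z w × Proportional w z → w ∈ applyUpTo (cycle ∘ (ℕ._* r)) d
      member⇐ w ((j , w≡cⱼ) , w∝z) =
        ≡.subst (_∈ applyUpTo (cycle ∘ (ℕ._* r)) d) (sym (trans w≡cⱼ cⱼ≡)) (∈-applyUpTo⁺ (cycle ∘ (ℕ._* r)) (m%n<n c d))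
        where
        r∣j = Equivalence.to (proportional⇔ 0 j) (≡.subst (λ u → Proportional u z) w≡cⱼ w∝z)
        c = ℕ.quotient r∣j
        j≡ : j ≡ c % d ℕ.* r ℕ.+ c / d ℕ.* N
        j≡ = trans (ℕ._∣_.equality r∣j) (trans (m*n≡m%d*n+m/d*[d*n] c r d) (cong (λ x → c % d ℕ.* r ℕ.+ c / d ℕ.* x) d*r≡N))
        cⱼ≡ : cycle j ≡ cycle (c % d ℕ.* r)
        cⱼ≡ = trans (cong cycle j≡) (Equivalence.from (cycle-+≡⇔ (c % d ℕ.* r) (c / d ℕ.* N)) (n∣m*n (c / d)))

    cycle-counts : NumClasses z r × ClassSize z d
    cycle-counts = numClasses-cycle , classSize-cycle

-- Both counts depend only on N and q.
corollary3 : ∀ {q : ℕ} (K : FiniteField q) → IsPrimePower q → 2 < q →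
    let open PolyOps K in
    ∀ (n : ℕ) → 1 ≤ n → Coprime n q →
    ∀ (h₁ h₂ g₁ g₂ : Poly) (N m : ℕ) →
    Irreducible h₁ → Irreducible h₂ →
    g₁ *ₚ h₁ ≈ₚ xᵉ-1 n → g₂ *ₚ h₂ ≈ₚ xᵉ-1 n →
    Order h₁ N → Order h₂ N → Degree h₁ m → Degree h₂ m → 1 < m →
    N ≢ q ^ m ∸ 1 →
    ∃₂ λ (r d : ℕ) → ∀ (z : A n) → InIdeal n g₁ z ⊎ InIdeal n g₂ z →
      z ≢ zeroA n → NumClasses z r × ClassSize z d
corollary3 {suc (suc (suc _))} K _ (s≤s (s≤s (s≤s _))) (suc n′) _ _ h₁ h₂ g₁ g₂ N m
           irreducible₁ irreducible₂ g₁h₁≈ g₂h₂≈ order₁ order₂ deg₁ deg₂ 1<m _ =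
  classesPerCycle N , elementsPerClass N , λ
    { z (inj₁ (a , z≡ag₁)) z≢0 → counts deg₁ irreducible₁ order₁ g₁h₁≈ a z≡ag₁ z≢0
    ; z (inj₂ (a , z≡ag₂)) z≢0 → counts deg₂ irreducible₂ order₂ g₂h₂≈ a z≡ag₂ z≢0 }
  where
  open Cycles K n′
  counts : ∀ {h g z} → Degree h m → Irreducible h → Order h N → g *ₚ h ≈ₚ xᵉ-1 (suc n′) →
           ∀ a → z ≡ reduce (suc n′) (a *ₚ g) → z ≢ zeroA (suc n′) →
           NumClasses z (classesPerCycle N) × ClassSize z (elementsPerClass N)
  counts deg irreducible order gh≈ a z≡ag z≢0 =
    ≡.subst (λ w → NumClasses w (classesPerCycle N) × ClassSize w (elementsPerClass N)) (≡.sym z≡ag)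
            (cycle-counts deg (ℕ.<⇒≤ 1<m) irreducible order gh≈ a (λ ag≡0 → z≢0 (≡.trans z≡ag ag≡0)))
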